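{- Let $n\ge 3$ be an integer and let $G=K_n\square P_3$, i.e. three disjoint copies of $K_n$ with vertices $v_{i,1},\dots,v_{i,n}$ ($i=1,2,3$) together with the edges $v_{1,p}v_{2,p}$ and $v_{2,p}v_{3,p}$ for $1\le p\le n$. Then $G$ is a non-regular minimally $\frac{n+1}{3}$-tough graph with $\delta(G)=\Delta(G)-1=n$. Moreover, let $G_0$ be the graph obtained from $G$ by deleting the vertex $v_{2,p}$ for some $p$ (the middle vertex of the induced path $v_{1,p}v_{2,p}v_{3,p}$) and adding the new edge $v_{1,p}v_{3,p}$. Then $G_0$ is $n$-regular and minimally $\frac{n+1}{3}$-tough.
   Context: All graphs are finite and simple. $K_n\square P_3$ is the Cartesian product of the complete graph $K_n$ and the path $P_3$. $\delta(G)$ and $\Delta(G)$ denote minimum and maximum degree; a graph is $r$-regular if all degrees equal $r$. For a graph $G$, $\omega(G)$ denotes the number of components. For a positive real $t$, $G$ is $t$-tough if $\omega(G\setminus S)\le \max\{1,|S|/t\}$ for every $S\subseteq V(G)$; the toughness $t(G)$ is the largest such $t$. $G$ is minimally $t$-tough if $t(G)=t$ and $G-e$ is not $t$-tough for every edge $e\in E(G)$. -}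

module Defs where

open import Data.Bool using (Bool; true; false; _∧_; _∨_; not)
open import Data.Nat using (ℕ; zero; suc; _≤_; _+_; _*_; pred)
open import Data.Fin using (Fin; combine; remQuot; punchIn) renaming (zero to fz; suc to fs)
open import Data.Fin.Properties using (_≟_)
open import Data.Fin.Subset using (Subset; _∉_; ∣_∣)
open import Data.Vec using (tabulate)
open import Data.Product using (Σ; ∃; _×_; _,_; proj₁; proj₂)
open import Data.Sum using (_⊎_)
open import Data.Integer using (+_)
open import Data.Rational using (ℚ; _/_) renaming (_≤_ to _≤ℚ_; _<_ to _<ℚ_; _*_ to _*ℚ_)
open import Relation.Nullary using (¬_; does)
open import Relation.Binary.PropositionalEquality using (_≡_)
open import Relation.Binary.Construct.Closure.ReflexiveTransitive using (Star)
open import Function.Bundles using (_⇔_)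

record Graph : Set where
  field
    N   : ℕ
    adj : Fin N → Fin N → Bool
open Graph public

IsSimple : Graph → Set
IsSimple G = (∀ u v → adj G u v ≡ adj G v u) × (∀ v → adj G v v ≡ false)

ℕ→ℚ : ℕ → ℚ
ℕ→ℚ k = (+ k) / 1

_==_ : ∀ {m} → Fin m → Fin m → Bool
x == y = does (x ≟ y)

deg : (G : Graph) → Fin (N G) → ℕ
deg G v = ∣ tabulate (adj G v) ∣

MinDegreeIs : Graph → ℕ → Set
MinDegreeIs G d = (∀ v → d ≤ deg G v) × (∃ λ v → deg G v ≡ d)

MaxDegreeIs : Graph → ℕ → Set
MaxDegreeIs G d = (∀ v → deg G v ≤ d) × (∃ λ v → deg G v ≡ d)

Regular : Graph → ℕ → Set
Regular G r = ∀ v → deg G v ≡ r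

Step : (G : Graph) → Subset (N G) → Fin (N G) → Fin (N G) → Set
Step G S u v = (u ∉ S) × (v ∉ S) × (adj G u v ≡ true)

Reach : (G : Graph) → Subset (N G) → Fin (N G) → Fin (N G) → Set
Reach G S = Star (Step G S)

-- ω(G \ S) = k : there is a surjective labelling of the vertices of G \ S
-- by Fin k whose fibres are exactly the connected components.
NumComponents : (G : Graph) → Subset (N G) → ℕ → Set
NumComponents G S k =
  Σ ((v : Fin (N G)) → v ∉ S → Fin k) λ c →
    (∀ (i : Fin k) → ∃ λ v → Σ (v ∉ S) λ h → c v h ≡ i) ×
    (∀ u v (hu : u ∉ S) (hv : v ∉ S) → (c u hu ≡ c v hv) ⇔ Reach G S u v)

-- G is t-tough: ω(G\S) ≤ max{1, |S|/t} for all S, i.e. ω ≤ 1 or ω·t ≤ |S|.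
Tough : Graph → ℚ → Set
Tough G t = ∀ (S : Subset (N G)) (k : ℕ) → NumComponents G S k →
  (k ≤ 1) ⊎ (ℕ→ℚ k *ℚ t ≤ℚ ℕ→ℚ ∣ S ∣)

ToughnessIs : Graph → ℚ → Set
ToughnessIs G t = Tough G t × (∀ t' → t <ℚ t' → ¬ Tough G t')

removeEdge : (G : Graph) → Fin (N G) → Fin (N G) → Graph
removeEdge G u v = record
  { N = N G
  ; adj = λ x y → adj G x y ∧ not ((x == u ∧ y == v) ∨ (x == v ∧ y == u)) }

MinimallyTough : Graph → ℚ → Set
MinimallyTough G t = ToughnessIs G t ×
  (∀ u v → adj G u v ≡ true → ¬ Tough (removeEdge G u v) t)

-- K_n □ P_3.  Vertex v_{i,p} (i ∈ {1,2,3}, p ∈ {1..n}) is encoded as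
-- combine i' p' : Fin (3 * n) with i' = i-1 : Fin 3, p' = p-1 : Fin n.

vtx : ∀ {n} → Fin 3 → Fin n → Fin (3 * n)
vtx i p = combine i p

adjP3 : Fin 3 → Fin 3 → Bool
adjP3 fz      (fs fz) = true
adjP3 (fs fz) fz      = true
adjP3 (fs fz) (fs (fs fz)) = true
adjP3 (fs (fs fz)) (fs fz) = true
adjP3 _ _ = false

adjKP : (n : ℕ) → Fin (3 * n) → Fin (3 * n) → Bool
adjKP n x y with remQuot {3} n x | remQuot {3} n y
... | (i , p) | (j , q) = (i == j ∧ not (p == q)) ∨ (p == q ∧ adjP3 i j)

KnP3 : ℕ → Graph
KnP3 n = record { N = 3 * n ; adj = adjKP n }

-- G₀: delete v_{2,p} from K_n □ P_3 and add the edge v_{1,p} v_{3,p}.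
-- Vertices of G₀ are Fin (3n - 1), embedded into Fin (3n) by skipping v_{2,p}.
G₀ : (n : ℕ) → Fin n → Graph
G₀ (suc k) p = record { N = pred (3 * suc k) ; adj = adj₀ }
  where
  ι : Fin (pred (3 * suc k)) → Fin (3 * suc k)
  ι = punchIn (vtx (fs fz) p)
  new : Fin (3 * suc k) → Fin (3 * suc k) → Bool
  new a b = (a == vtx fz p ∧ b == vtx (fs (fs fz)) p)
          ∨ (a == vtx (fs (fs fz)) p ∧ b == vtx fz p)
  adj₀ : Fin (pred (3 * suc k)) → Fin (pred (3 * suc k)) → Bool
  adj₀ x y = adjKP (suc k) (ι x) (ι y) ∨ new (ι x) (ι y)

module Submission where

-- View K_n □ P_3 as a grid: row i ∈ {0,1,2} is a copy of K_n, column q the path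
-- (0,q)(1,q)(2,q).  Surviving vertices of one row stay connected, so G ∖ S has at most one
-- component per row.  With two components S meets every column, and with three the column of
-- the middle-row component loses both outer vertices; hence |S| ≥ n resp. n + 1, i.e. the
-- toughness is at least (n+1)/3.  In G₀ the deleted vertex (1,p) acts as a member of S and the
-- new edge (0,p)(2,p) forces one more.
--
-- The upper bounds (toughness at most (n+1)/3, and below it after removing any edge) are given
-- by explicit cuts.  Naming at most three columns and lumping all others together, the graph,
-- the cut and a labelling of its components depend only on rows and these column types; a
-- finite boolean check, run by evaluation, then certifies ω(G ∖ S) for all n at once.

open import Defs
import Data.Nat.Properties as ℕ
open import Data.Nat.Tactic.RingSolver using (solve-∀)
open import Algebra.Properties.CommutativeSemigroup ℕ.+-commutativeSemigroup
  using () renaming (interchange to +-interchange)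
open import Algebra.Properties.Semiring.Sum ℕ.+-*-semiring
  using (sum; sum-remove; sum-cong-≗; sum-replicate-zero; ∑-distrib-+; ∑-comm; *-distribˡ-sum; *-distribʳ-sum)
open import Data.Bool using (Bool; true; false; _∧_; _∨_; not; if_then_else_)
open import Data.Bool.Properties using (∧-zeroʳ; ∨-zeroʳ; ∨-comm; ∧-comm)
open import Data.Nat using (ℕ; zero; suc; _+_; _*_; _≤_; _<_; z≤n; s≤s; pred)
open import Data.Fin using (Fin; _↑ˡ_; _↑ʳ_; combine; remQuot; punchIn; punchOut; inject≤; fromℕ<)
  renaming (zero to fz; suc to fs)
open import Data.Fin.Patterns using (0F; 1F; 2F; 3F)
open import Data.Fin.Properties
  using (_≟_; punchInᵢ≢i; punchIn-punchOut; punchIn-injective; punchOut-injective; combine-injectiveˡ;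
         combine-injectiveʳ; remQuot-combine; combine-remQuot; inject≤-injective; pigeonhole; any?; <⇒≢)
open import Data.Fin.Subset using (Subset; _∉_; ∣_∣)
open import Data.Vec using (tabulate; lookup; insertAt)
open import Data.Vec.Properties
  using (tabulate∘lookup; lookup∘tabulate; []=⇒lookup; lookup⇒[]=; insertAt-lookup; insertAt-punchIn)
open import Relation.Binary.PropositionalEquality
  using (_≡_; _≢_; refl; sym; trans; cong; cong₂; subst; subst₂; module ≡-Reasoning)
open import Data.Product using (Σ; ∃; _×_; _,_; proj₁; proj₂)
open import Data.Empty using (⊥-elim)
open import Data.List using (List; []; _∷_)
open import Data.Sum using (_⊎_; inj₁; inj₂; [_,_]′)
open import Relation.Binary.Construct.Closure.ReflexiveTransitive using (ε; _◅_; _◅◅_; reverse)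
open import Function.Bundles using (mk⇔; Equivalence)
open import Data.Integer using (+_; +≤+) renaming (_≤_ to _≤ℤ_)
import Data.Integer.Properties as ℤ
open import Data.Rational using (ℚ; _/_; toℚᵘ) renaming (_≤_ to _≤ℚ_; _<_ to _<ℚ_; _*_ to _*ℚ_)
import Data.Rational.Properties as ℚ
open import Data.Rational.Unnormalised using (mkℚᵘ; *≤*) renaming (_≤_ to _≤ᵘ_; _≃_ to _≃ᵘ_)
import Data.Rational.Unnormalised.Properties as ℚᵘ
open import Relation.Nullary using (¬_; yes; no)
open import Relation.Nullary.Decidable using (dec-true; dec-false)
open import Data.Maybe using (Maybe; just; nothing; is-nothing; is-just)
import Data.Maybe as Maybe
open import Function using (_∘_)
open import Function.Definitions using (Injective)

bit : Bool → ℕ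
bit true  = 1
bit false = 0

count : ∀ {n} → (Fin n → Bool) → ℕ
count f = sum (bit ∘ f)

∣tabulate∣≡count : ∀ {n} (f : Fin n → Bool) → ∣ tabulate f ∣ ≡ count f
∣tabulate∣≡count {zero}  f = refl
∣tabulate∣≡count {suc n} f with f fz
... | true  = cong suc (∣tabulate∣≡count (f ∘ fs))
... | false = ∣tabulate∣≡count (f ∘ fs)

∣S∣≡count : ∀ {n} (S : Subset n) → ∣ S ∣ ≡ count (lookup S)
∣S∣≡count S = trans (cong ∣_∣ (sym (tabulate∘lookup S))) (∣tabulate∣≡count (lookup S))

count-cong : ∀ {n} {f g : Fin n → Bool} → (∀ x → f x ≡ g x) → count f ≡ count g
count-cong f≗g = sum-cong-≗ (cong bit ∘ f≗g)

count-remove : ∀ {n} (i : Fin (suc n)) (f : Fin (suc n) → Bool) → count f ≡ bit (f i) + count (f ∘ punchIn i)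
count-remove i f = sum-remove {i = i} (bit ∘ f)

sum-++ : ∀ m {n} (f : Fin (m + n) → ℕ) → sum f ≡ sum (λ x → f (x ↑ˡ n)) + sum (λ x → f (m ↑ʳ x))
sum-++ zero    f = refl
sum-++ (suc m) f = trans (cong (_+_ (f fz)) (sum-++ m (f ∘ fs))) (sym (ℕ.+-assoc (f fz) _ _))

sum-combine : ∀ m {n} (f : Fin (m * n) → ℕ) → sum f ≡ sum (λ i → sum (λ q → f (combine {m} {n} i q)))
sum-combine zero    f = refl
sum-combine (suc m) {n} f =
  trans (sum-++ n f) (cong (_+_ (sum (λ q → f (combine {suc m} fz q)))) (sum-combine m (λ x → f (n ↑ʳ x))))

count-true : ∀ n → count {n} (λ _ → true) ≡ n
count-true zero    = refl
count-true (suc n) = cong suc (count-true n)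

count-false : ∀ n → count {n} (λ _ → false) ≡ 0
count-false zero    = refl
count-false (suc n) = count-false n

count-≥1 : ∀ {n} (f : Fin n → Bool) {i} → f i ≡ true → 1 ≤ count f
count-≥1 {suc n} f {i} fi rewrite count-remove i f | fi = s≤s z≤n

count-≥2 : ∀ {n} (f : Fin n → Bool) {i j} → i ≢ j → f i ≡ true → f j ≡ true → 2 ≤ count f
count-≥2 {suc n} f {i} {j} i≢j fi fj rewrite count-remove i f | fi =
  s≤s (count-≥1 (f ∘ punchIn i) (trans (cong f (punchIn-punchOut i≢j)) fj))

sum-≥n : ∀ {n} (f : Fin n → ℕ) → (∀ q → 1 ≤ f q) → n ≤ sum f
sum-≥n {zero}  f f≥1 = z≤n
sum-≥n {suc n} f f≥1 = ℕ.+-mono-≤ (f≥1 fz) (sum-≥n (f ∘ fs) (f≥1 ∘ fs))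

sum-≥1+n : ∀ {n} (f : Fin n → ℕ) → (∀ q → 1 ≤ f q) → ∀ {q₀} → 2 ≤ f q₀ → suc n ≤ sum f
sum-≥1+n {suc n} f f≥1 {q₀} fq₀≥2 rewrite sum-remove {i = q₀} f =
  ℕ.+-mono-≤ fq₀≥2 (sum-≥n (f ∘ punchIn q₀) (f≥1 ∘ punchIn q₀))

sum-≥2+n : ∀ {n} (f : Fin n → ℕ) → (∀ q → 1 ≤ f q) → ∀ {q₀ q₁} → q₀ ≢ q₁ →
  2 ≤ f q₀ → 2 ≤ f q₁ → suc (suc n) ≤ sum f
sum-≥2+n {suc n} f f≥1 {q₀} q₀≢q₁ fq₀≥2 fq₁≥2 rewrite sum-remove {i = q₀} f =
  ℕ.+-mono-≤ fq₀≥2 (sum-≥1+n (f ∘ punchIn q₀) (f≥1 ∘ punchIn q₀)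
    (subst (λ q → 2 ≤ f q) (sym (punchIn-punchOut q₀≢q₁)) fq₁≥2))

==-refl : ∀ {n} (q : Fin n) → (q == q) ≡ true
==-refl q = dec-true (q ≟ q) refl

==-≢ : ∀ {n} {q r : Fin n} → q ≢ r → (q == r) ≡ false
==-≢ {q = q} {r} = dec-false (q ≟ r)

==⇒≡ : ∀ {n} {q r : Fin n} → (q == r) ≡ true → q ≡ r
==⇒≡ {q = q} {r} h with q ≟ r
... | yes q≡r = q≡r

≢-== : ∀ {n} {q r : Fin n} → (q == r) ≡ false → q ≢ r
≢-== {q = q} h refl with trans (sym h) (==-refl q)
... | ()

==-sym : ∀ {n} (q r : Fin n) → (q == r) ≡ (r == q)
==-sym q r with q ≟ r | r ≟ q
... | yes _   | yes _   = refl
... | yes q≡r | no r≢q  = ⊥-elim (r≢q (sym q≡r))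
... | no q≢r  | yes r≡q = ⊥-elim (q≢r (sym r≡q))
... | no _    | no _    = refl

==-combine : ∀ {m n} (i j : Fin m) (q r : Fin n) → (combine i q == combine j r) ≡ (i == j ∧ q == r)
==-combine i j q r with i ≟ j
... | no i≢j = ==-≢ (i≢j ∘ combine-injectiveˡ i q j r)
==-combine i .i q r | yes refl with q ≟ r
... | yes refl = ==-refl (combine i q)
... | no q≢r   = ==-≢ (q≢r ∘ combine-injectiveʳ i q i r)

==-punchIn : ∀ {n} (w : Fin (suc n)) a x → (punchIn w a == punchIn w x) ≡ (a == x)
==-punchIn w a x with a ≟ x
... | yes refl = ==-refl (punchIn w a)
... | no a≢x   = ==-≢ (a≢x ∘ punchIn-injective w a x)

∧-trueˡ : ∀ {a b} → a ∧ b ≡ true → a ≡ true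
∧-trueˡ {true} _ = refl

∧-trueʳ : ∀ {a b} → a ∧ b ≡ true → b ≡ true
∧-trueʳ {true} h = h

∨-trueʳ : ∀ {a b} → a ∨ b ≡ true → a ≡ false → b ≡ true
∨-trueʳ {false} h refl = h

not-true : ∀ {a} → not a ≡ true → a ≡ false
not-true {false} _ = refl

allFin : ∀ {m} → (Fin m → Bool) → Bool
allFin {zero}  f = true
allFin {suc m} f = f fz ∧ allFin (f ∘ fs)

allFin-sound : ∀ {m} (f : Fin m → Bool) → allFin f ≡ true → ∀ x → f x ≡ true
allFin-sound {suc m} f h fz     = ∧-trueˡ h
allFin-sound {suc m} f h (fs x) = allFin-sound (f ∘ fs) (∧-trueʳ {f fz} h) x

allType : ∀ {m} → (Maybe (Fin m) → Bool) → Bool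
allType f = f nothing ∧ allFin (f ∘ just)

allType-sound : ∀ {m} (f : Maybe (Fin m) → Bool) → allType f ≡ true → ∀ x → f x ≡ true
allType-sound f h nothing  = ∧-trueˡ h
allType-sound f h (just x) = allFin-sound (f ∘ just) (∧-trueʳ {f nothing} h) x

allBool : (Bool → Bool) → Bool
allBool f = f true ∧ f false

allBool-sound : ∀ f → allBool f ≡ true → ∀ x → f x ≡ true
allBool-sound f h true  = ∧-trueˡ h
allBool-sound f h false = ∧-trueʳ {f true} h

∨-introˡ : ∀ {a} b → a ≡ true → a ∨ b ≡ true
∨-introˡ b refl = refl

∨-cases : ∀ a {b} → a ∨ b ≡ true → a ≡ true ⊎ b ≡ true
∨-cases true  _ = inj₁ refl
∨-cases false h = inj₂ h

typeOf : ∀ {n m} → (Fin m → Fin n) → Fin n → Maybe (Fin m)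
typeOf {m = zero}  d q = nothing
typeOf {m = suc m} d q = if q == d fz then just fz else Maybe.map fs (typeOf (d ∘ fs) q)

typeOf-just : ∀ {n m} (d : Fin m → Fin n) q k → typeOf d q ≡ just k → q ≡ d k
typeOf-just {m = suc m} d q k h with q ≟ d fz
typeOf-just {m = suc m} d q fz refl | yes q≡d0 = q≡d0
typeOf-just {m = suc m} d q k h | no _ with typeOf (d ∘ fs) q in eq
typeOf-just {m = suc m} d q (fs k) refl | no _ | just _ = typeOf-just (d ∘ fs) q k eq

typeOf-nothing : ∀ {n m} (d : Fin m → Fin n) o → (∀ k → o ≢ d k) → typeOf d o ≡ nothing
typeOf-nothing {m = zero}  d o o∉d = refl
typeOf-nothing {m = suc m} d o o∉d rewrite ==-≢ (o∉d fz) = cong (Maybe.map fs) (typeOf-nothing (d ∘ fs) o (o∉d ∘ fs))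

typeOf-d : ∀ {n m} (d : Fin m → Fin n) → Injective _≡_ _≡_ d → ∀ k → typeOf d (d k) ≡ just k
typeOf-d {m = suc m} d d-inj fz rewrite ==-refl (d fz) = refl
typeOf-d {m = suc m} d d-inj (fs k) with d (fs k) ≟ d fz
... | yes dk≡d0 with () ← d-inj dk≡d0
... | no _ rewrite typeOf-d (d ∘ fs) (Data.Fin.Properties.suc-injective ∘ d-inj) k = refl

_==ᵗ_ : ∀ {m} → Maybe (Fin m) → Maybe (Fin m) → Bool
nothing ==ᵗ nothing = true
just a  ==ᵗ just b  = a == b
_       ==ᵗ _       = false

==ᵗ-refl : ∀ {m} (x : Maybe (Fin m)) → (x ==ᵗ x) ≡ true
==ᵗ-refl nothing  = refl
==ᵗ-refl (just a) = ==-refl a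

==ᵗ⇒≡ : ∀ {m} {x y : Maybe (Fin m)} → (x ==ᵗ y) ≡ true → x ≡ y
==ᵗ⇒≡ {x = nothing} {nothing} h = refl
==ᵗ⇒≡ {x = just a}  {just b}  h = cong just (==⇒≡ h)

==-d≡typeOf : ∀ {n m} (d : Fin m → Fin n) → Injective _≡_ _≡_ d → ∀ q k → (q == d k) ≡ (typeOf d q ==ᵗ just k)
==-d≡typeOf d d-inj q k with q ≟ d k
... | yes refl rewrite typeOf-d d d-inj k = sym (==-refl k)
... | no q≢dk with typeOf d q in eq
... | nothing = refl
... | just k' with k' ≟ k
... | yes refl = ⊥-elim (q≢dk (typeOf-just d q k eq))
... | no _     = refl

count-single : ∀ {n} (a : Fin n) → count (_== a) ≡ 1
count-single {suc n} a = begin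
  count (_== a)                             ≡⟨ count-remove a (_== a) ⟩
  bit (a == a) + count ((_== a) ∘ punchIn a) ≡⟨ cong₂ _+_ (cong bit (==-refl a)) (count-cong (==-≢ ∘ punchInᵢ≢i a)) ⟩
  1 + count {n} (λ _ → false)               ≡⟨ cong suc (count-false n) ⟩
  1                                         ∎
  where open ≡-Reasoning

sum-δ : ∀ {m} (f : Fin m → ℕ) k₀ → sum (λ k → f k * bit (k₀ == k)) ≡ f k₀
sum-δ {suc m} f k₀ = begin
  sum (λ k → f k * bit (k₀ == k))
    ≡⟨ sum-remove {i = k₀} (λ k → f k * bit (k₀ == k)) ⟩
  f k₀ * bit (k₀ == k₀) + sum (λ k → f (punchIn k₀ k) * bit (k₀ == punchIn k₀ k))
    ≡⟨ cong₂ _+_ (cong (λ b → f k₀ * bit b) (==-refl k₀))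
                 (sum-cong-≗ λ k → cong (λ b → f (punchIn k₀ k) * bit b) (==-≢ (punchInᵢ≢i k₀ k ∘ sym))) ⟩
  f k₀ * 1 + sum (λ k → f (punchIn k₀ k) * 0)
    ≡⟨ cong₂ _+_ (ℕ.*-identityʳ (f k₀)) (trans (sum-cong-≗ (ℕ.*-zeroʳ ∘ f ∘ punchIn k₀)) (sum-replicate-zero m)) ⟩
  f k₀ + 0
    ≡⟨ ℕ.+-identityʳ (f k₀) ⟩
  f k₀ ∎
  where open ≡-Reasoning

count-∘ : ∀ {n m} (h : Fin n → Maybe (Fin m)) (g : Maybe (Fin m) → Bool) →
  count (g ∘ h) ≡ bit (g nothing) * count (is-nothing ∘ h) + sum (λ k → bit (g (just k)) * count (λ q → h q ==ᵗ just k))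
count-∘ {n} {m} h g = begin
  sum (λ q → bit (g (h q)))
    ≡⟨ sum-cong-≗ (decompose ∘ h) ⟩
  sum (λ q → Gₒ * bit (is-nothing (h q)) + sum (λ k → G k * bit (h q ==ᵗ just k)))
    ≡⟨ ∑-distrib-+ (λ q → Gₒ * bit (is-nothing (h q))) (λ q → sum (λ k → G k * bit (h q ==ᵗ just k))) ⟩
  sum (λ q → Gₒ * bit (is-nothing (h q))) + sum (λ q → sum (λ k → G k * bit (h q ==ᵗ just k)))
    ≡⟨ cong₂ _+_ (sym (*-distribˡ-sum Gₒ (bit ∘ is-nothing ∘ h))) (∑-comm (λ q k → G k * bit (h q ==ᵗ just k))) ⟩
  Gₒ * count (is-nothing ∘ h) + sum (λ k → sum (λ q → G k * bit (h q ==ᵗ just k)))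
    ≡⟨ cong (_+_ (Gₒ * count (is-nothing ∘ h))) (sum-cong-≗ λ k → sym (*-distribˡ-sum (G k) (λ q → bit (h q ==ᵗ just k)))) ⟩
  Gₒ * count (is-nothing ∘ h) + sum (λ k → G k * count (λ q → h q ==ᵗ just k)) ∎
  where
  open ≡-Reasoning
  Gₒ = bit (g nothing)
  G : Fin m → ℕ
  G k = bit (g (just k))
  decompose : ∀ x → bit (g x) ≡ Gₒ * bit (is-nothing x) + sum (λ k → G k * bit (x ==ᵗ just k))
  decompose nothing = sym (begin
    Gₒ * 1 + sum (λ k → G k * 0) ≡⟨ cong₂ _+_ (ℕ.*-identityʳ Gₒ) (trans (sum-cong-≗ (ℕ.*-zeroʳ ∘ G)) (sum-replicate-zero m)) ⟩
    Gₒ + 0                       ≡⟨ ℕ.+-identityʳ Gₒ ⟩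
    Gₒ                           ∎)
  decompose (just k₀) = sym (trans (cong (_+ sum (λ k → G k * bit (k₀ == k))) (ℕ.*-zeroʳ Gₒ)) (sum-δ G k₀))

others : ∀ {n m} → (Fin m → Fin n) → ℕ
others d = count (is-nothing ∘ typeOf d)

count-byType : ∀ {n m} (d : Fin m → Fin n) → Injective _≡_ _≡_ d → (g : Maybe (Fin m) → Bool) →
  count (g ∘ typeOf d) ≡ bit (g nothing) * others d + sum (bit ∘ g ∘ just)
count-byType d d-inj g = trans (count-∘ (typeOf d) g) (cong (_+_ (bit (g nothing) * others d)) (sum-cong-≗ λ k →
  trans (cong (bit (g (just k)) *_) (trans (count-cong λ q → sym (==-d≡typeOf d d-inj q k)) (count-single (d k))))
        (ℕ.*-identityʳ _)))

n≡others+m : ∀ {n m} (d : Fin m → Fin n) → Injective _≡_ _≡_ d → n ≡ others d + m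
n≡others+m {n} {m} d d-inj = begin
  n                                          ≡⟨ sym (count-true n) ⟩
  count {n} (λ _ → true)                     ≡⟨ count-byType d d-inj (λ _ → true) ⟩
  1 * others d + sum {m} (λ _ → 1)           ≡⟨ cong₂ _+_ (ℕ.*-identityˡ (others d)) (count-true m) ⟩
  others d + m                               ∎
  where open ≡-Reasoning

count-typed : ∀ {n m} (d : Fin m → Fin n) → Injective _≡_ _≡_ d →
  (f : Fin (3 * n) → Bool) (g : Fin 3 → Maybe (Fin m) → Bool) →
  (∀ i q → f (vtx i q) ≡ g i (typeOf d q)) →
  count f ≡ sum (λ i → bit (g i nothing)) * others d + sum (λ i → sum (bit ∘ g i ∘ just))
count-typed {n} d d-inj f g f≡g = begin
  sum (bit ∘ f)                                                  ≡⟨ sum-combine 3 {n} (bit ∘ f) ⟩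
  sum (λ i → sum (λ (q : Fin n) → bit (f (vtx i q))))            ≡⟨ sum-cong-≗ (λ i → count-cong (f≡g i)) ⟩
  sum (λ i → count (g i ∘ typeOf d))                             ≡⟨ sum-cong-≗ (λ i → count-byType d d-inj (g i)) ⟩
  sum (λ i → bit (g i nothing) * others d + sum (bit ∘ g i ∘ just))
    ≡⟨ ∑-distrib-+ (λ i → bit (g i nothing) * others d) (λ i → sum (bit ∘ g i ∘ just)) ⟩
  sum (λ i → bit (g i nothing) * others d) + sum (λ i → sum (bit ∘ g i ∘ just))
    ≡⟨ cong (_+ sum (λ i → sum (bit ∘ g i ∘ just))) (sym (*-distribʳ-sum (others d) (λ i → bit (g i nothing)))) ⟩
  sum (λ i → bit (g i nothing)) * others d + sum (λ i → sum (bit ∘ g i ∘ just)) ∎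
  where open ≡-Reasoning

cols₁ : ∀ {n} → Fin n → Fin 1 → Fin n
cols₁ a _ = a

cols₂ : ∀ {n} → Fin n → Fin n → Fin 2 → Fin n
cols₂ a b fz      = a
cols₂ a b (fs fz) = b

cols₃ : ∀ {n} → Fin n → Fin n → Fin n → Fin 3 → Fin n
cols₃ a b c fz           = a
cols₃ a b c (fs fz)      = b
cols₃ a b c (fs (fs fz)) = c

cols₁-injective : ∀ {n} (a : Fin n) → Injective _≡_ _≡_ (cols₁ a)
cols₁-injective a {fz} {fz} _ = refl

cols₂-injective : ∀ {n} {a b : Fin n} → a ≢ b → Injective _≡_ _≡_ (cols₂ a b)
cols₂-injective a≢b {fz}    {fz}    _ = refl
cols₂-injective a≢b {fz}    {fs fz} e = ⊥-elim (a≢b e)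
cols₂-injective a≢b {fs fz} {fz}    e = ⊥-elim (a≢b (sym e))
cols₂-injective a≢b {fs fz} {fs fz} _ = refl

cols₃-injective : ∀ {n} {a b c : Fin n} → a ≢ b → a ≢ c → b ≢ c → Injective _≡_ _≡_ (cols₃ a b c)
cols₃-injective a≢b a≢c b≢c {fz}         {fz}         _ = refl
cols₃-injective a≢b a≢c b≢c {fz}         {fs fz}      e = ⊥-elim (a≢b e)
cols₃-injective a≢b a≢c b≢c {fz}         {fs (fs fz)} e = ⊥-elim (a≢c e)
cols₃-injective a≢b a≢c b≢c {fs fz}      {fz}         e = ⊥-elim (a≢b (sym e))
cols₃-injective a≢b a≢c b≢c {fs fz}      {fs fz}      _ = refl
cols₃-injective a≢b a≢c b≢c {fs fz}      {fs (fs fz)} e = ⊥-elim (b≢c e)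
cols₃-injective a≢b a≢c b≢c {fs (fs fz)} {fz}         e = ⊥-elim (a≢c (sym e))
cols₃-injective a≢b a≢c b≢c {fs (fs fz)} {fs fz}      e = ⊥-elim (b≢c (sym e))
cols₃-injective a≢b a≢c b≢c {fs (fs fz)} {fs (fs fz)} _ = refl

count-∨ : ∀ {n} (f g : Fin n → Bool) → count (λ q → f q ∨ g q) ≤ count f + count g
count-∨ {zero}  f g = z≤n
count-∨ {suc n} f g = begin
  bit (f fz ∨ g fz) + count (λ q → f (fs q) ∨ g (fs q)) ≤⟨ ℕ.+-mono-≤ (bit-∨ (f fz) (g fz)) (count-∨ (f ∘ fs) (g ∘ fs)) ⟩
  (bit (f fz) + bit (g fz)) + (count (f ∘ fs) + count (g ∘ fs))
    ≡⟨ +-interchange (bit (f fz)) (bit (g fz)) (count (f ∘ fs)) (count (g ∘ fs)) ⟩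
  count f + count g ∎
  where
  open ℕ.≤-Reasoning
  bit-∨ : ∀ a b → bit (a ∨ b) ≤ bit a + bit b
  bit-∨ true  b = s≤s z≤n
  bit-∨ false b = ℕ.≤-refl

count<⇒false : ∀ {n} (f : Fin n → Bool) → count f < n → ∃ λ q → f q ≡ false
count<⇒false {suc n} f cf<n with f fz in f0
... | false = fz , f0
... | true  = let q , fq = count<⇒false (f ∘ fs) (ℕ.≤-pred cf<n) in fs q , fq

fresh : ∀ {n k} → k < n → (a : Fin k → Fin n) → ∃ λ o → ∀ i → o ≢ a i
fresh {n} {k} k<n a = let o , o∉a = count<⇒false (hits a) (ℕ.≤-<-trans (count-hits a) k<n) in o , missed a o o∉a
  where
  hits : ∀ {k} → (Fin k → Fin n) → Fin n → Bool
  hits {zero}  a q = false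
  hits {suc k} a q = q == a fz ∨ hits (a ∘ fs) q
  count-hits : ∀ {k} (a : Fin k → Fin n) → count (hits a) ≤ k
  count-hits {zero}  a = ℕ.≤-reflexive (count-false n)
  count-hits {suc k} a = ℕ.≤-trans (count-∨ (_== a fz) (hits (a ∘ fs)))
                                   (ℕ.+-mono-≤ (ℕ.≤-reflexive (count-single (a fz))) (count-hits (a ∘ fs)))
  missed : ∀ {k} (a : Fin k → Fin n) o → hits a o ≡ false → ∀ i → o ≢ a i
  missed {suc k} a o h fz      with o == a fz in e
  ... | false = ≢-== e
  missed {suc k} a o h (fs i) with o == a fz
  ... | false = missed (a ∘ fs) o h i

injective⇒surjective : ∀ {n} (f : Fin n → Fin n) → Injective _≡_ _≡_ f → ∀ r → ∃ λ l → f l ≡ r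
injective⇒surjective {suc n} f f-inj r with any? (λ l → f l ≟ r)
... | yes hit = hit
... | no miss = ⊥-elim (<⇒≢ i<j (f-inj (punchOut-injective (r≢f i) (r≢f j) eq)))
  where
  r≢f : ∀ l → r ≢ f l
  r≢f l r≡fl = miss (l , sym r≡fl)
  collision = pigeonhole (ℕ.n<1+n n) (λ l → punchOut (r≢f l))
  i = proj₁ collision
  j = proj₁ (proj₂ collision)
  i<j = proj₁ (proj₂ (proj₂ collision))
  eq = proj₂ (proj₂ (proj₂ collision))


τ : ℕ → ℚ
τ n = + suc n / 3

mkℚᵘ-≤ : ∀ a b c d → a * suc d ≤ b * suc c → mkℚᵘ (+ a) c ≤ᵘ mkℚᵘ (+ b) d
mkℚᵘ-≤ a b c d h = *≤* (subst₂ _≤ℤ_ (ℤ.pos-* a (suc d)) (ℤ.pos-* b (suc c)) (+≤+ h))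

mkℚᵘ-≤⁻¹ : ∀ a b c d → mkℚᵘ (+ a) c ≤ᵘ mkℚᵘ (+ b) d → a * suc d ≤ b * suc c
mkℚᵘ-≤⁻¹ a b c d (*≤* h) = ℤ.drop‿+≤+ (subst₂ _≤ℤ_ (sym (ℤ.pos-* a (suc d))) (sym (ℤ.pos-* b (suc c))) h)

toℚᵘ-/ : ∀ a d → toℚᵘ (+ a / suc d) ≃ᵘ mkℚᵘ (+ a) d
toℚᵘ-/ a d = ℚ.toℚᵘ-fromℚᵘ (mkℚᵘ (+ a) d)

toℚᵘ-ℕ*τ : ∀ k n → toℚᵘ (ℕ→ℚ k *ℚ τ n) ≃ᵘ mkℚᵘ (+ (k * suc n)) 2
toℚᵘ-ℕ*τ k n = ℚᵘ.≃-trans (ℚ.toℚᵘ-homo-* (ℕ→ℚ k) (τ n))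
  (ℚᵘ.≃-trans (ℚᵘ.*-cong (toℚᵘ-/ k 0) (toℚᵘ-/ (suc n) 2)) (ℚᵘ.≃-reflexive (cong (λ z → mkℚᵘ z 2) (sym (ℤ.pos-* k (suc n))))))

ℕ*τ≤ℕ⇒ : ∀ k n s → ℕ→ℚ k *ℚ τ n ≤ℚ ℕ→ℚ s → k * suc n ≤ 3 * s
ℕ*τ≤ℕ⇒ k n s h = subst₂ _≤_ (ℕ.*-identityʳ (k * suc n)) (ℕ.*-comm s 3)
  (mkℚᵘ-≤⁻¹ (k * suc n) s 2 0 (ℚᵘ.≤-respˡ-≃ (toℚᵘ-ℕ*τ k n) (ℚᵘ.≤-respʳ-≃ (toℚᵘ-/ s 0) (ℚ.toℚᵘ-mono-≤ h))))

ℕ*τ≤ℕ⇐ : ∀ k n s → k * suc n ≤ 3 * s → ℕ→ℚ k *ℚ τ n ≤ℚ ℕ→ℚ s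
ℕ*τ≤ℕ⇐ k n s h = ℚ.toℚᵘ-cancel-≤ (ℚᵘ.≤-respˡ-≃ (ℚᵘ.≃-sym (toℚᵘ-ℕ*τ k n)) (ℚᵘ.≤-respʳ-≃ (ℚᵘ.≃-sym (toℚᵘ-/ s 0))
  (mkℚᵘ-≤ (k * suc n) s 2 0 (subst₂ _≤_ (sym (ℕ.*-identityʳ (k * suc n))) (ℕ.*-comm 3 s) h))))

ℕ≤ℕ*τ⇐ : ∀ k n s → 3 * s ≤ k * suc n → ℕ→ℚ s ≤ℚ ℕ→ℚ k *ℚ τ n
ℕ≤ℕ*τ⇐ k n s h = ℚ.toℚᵘ-cancel-≤ (ℚᵘ.≤-respʳ-≃ (ℚᵘ.≃-sym (toℚᵘ-ℕ*τ k n)) (ℚᵘ.≤-respˡ-≃ (ℚᵘ.≃-sym (toℚᵘ-/ s 0))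
  (mkℚᵘ-≤ s (k * suc n) 0 2 (subst₂ _≤_ (ℕ.*-comm 3 s) (sym (ℕ.*-identityʳ (k * suc n))) h))))

τ<⇒ℕ*≰ : ∀ k n s {t'} → τ n <ℚ t' → 3 * s ≤ suc k * suc n → ¬ (ℕ→ℚ (suc k) *ℚ t' ≤ℚ ℕ→ℚ s)
τ<⇒ℕ*≰ k n s τ<t' 3s≤ k*t'≤s = ℚ.<-irrefl refl (ℚ.≤-<-trans (ℕ≤ℕ*τ⇐ (suc k) n s 3s≤)
  (ℚ.<-≤-trans (ℚ.*-monoʳ-<-pos (ℕ→ℚ (suc k)) {{ℚ.normalize-pos (suc k) 1}} τ<t') k*t'≤s))

lookup⇒∉ : ∀ {n} (S : Subset n) {x} → lookup S x ≡ false → x ∉ S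
lookup⇒∉ S Sx≡false x∈S with () ← trans (sym ([]=⇒lookup x∈S)) Sx≡false

∉⇒lookup : ∀ {n} (S : Subset n) {x} → x ∉ S → lookup S x ≡ false
∉⇒lookup S {x} x∉S with lookup S x in eq
... | true  = ⊥-elim (x∉S (lookup⇒[]= x S eq))
... | false = refl

graph : (M : ℕ) → (Fin M → Fin M → Bool) → Graph
graph M A = record { N = M ; adj = A }

Symmetric : Graph → Set
Symmetric G = ∀ u v → adj G u v ≡ true → adj G v u ≡ true

Reach-sym : ∀ {G S} → Symmetric G → ∀ {u v} → Reach G S u v → Reach G S v u
Reach-sym G-sym = reverse λ { (u∉S , v∉S , uv) → v∉S , u∉S , G-sym _ _ uv }

record Labelling (G : Graph) (S : Subset (N G)) (k : ℕ) : Set where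
  field
    label      : Fin (N G) → Fin k
    root       : Fin k → Fin (N G)
    root∉S     : ∀ l → root l ∉ S
    label-root : ∀ l → label (root l) ≡ l
    label-step : ∀ {u v} → Step G S u v → label u ≡ label v
    reach-root : ∀ u → u ∉ S → Reach G S u (root (label u))

labelling⇒numComponents : ∀ {G S k} → Symmetric G → Labelling G S k → NumComponents G S k
labelling⇒numComponents {G} {S} G-sym L =
  (λ v _ → label v) , (λ l → root l , root∉S l , label-root l) , λ u v u∉S v∉S → mk⇔ (same⇒reach u∉S v∉S) reach⇒same
  where
  open Labelling L
  same⇒reach : ∀ {u v} → u ∉ S → v ∉ S → label u ≡ label v → Reach G S u v
  same⇒reach {u} {v} u∉S v∉S lu≡lv =
    reach-root u u∉S ◅◅ subst (λ l → Reach G S (root l) v) (sym lu≡lv) (Reach-sym G-sym (reach-root v v∉S))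
  reach⇒same : ∀ {u v} → Reach G S u v → label u ≡ label v
  reach⇒same ε          = refl
  reach⇒same (st ◅ uv) = trans (label-step st) (reach⇒same uv)

record Scattered (G : Graph) (S : Subset (N G)) (k : ℕ) : Set where
  field
    pick   : Fin k → Fin (N G)
    pick∉S : ∀ i → pick i ∉ S
    apart  : ∀ {i j} → i ≢ j → ¬ Reach G S (pick i) (pick j)

numComponents⇒scattered : ∀ {G S k} → NumComponents G S k → Scattered G S k
numComponents⇒scattered (c , surj , c≡⇔reach) = record
  { pick   = proj₁ ∘ surj
  ; pick∉S = proj₁ ∘ proj₂ ∘ surj
  ; apart  = λ {i} {j} i≢j r →
      let u , u∉S , cu≡i = surj i ; v , v∉S , cv≡j = surj j
      in i≢j (trans (sym cu≡i) (trans (Equivalence.from (c≡⇔reach u v u∉S v∉S) r) cv≡j)) }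

scattered-≤ : ∀ {G S k k'} → k' ≤ k → Scattered G S k → Scattered G S k'
scattered-≤ k'≤k sc = record
  { pick   = pick ∘ λ i → inject≤ i k'≤k
  ; pick∉S = λ i → pick∉S (inject≤ i k'≤k)
  ; apart  = λ i≢j → apart (i≢j ∘ inject≤-injective k'≤k k'≤k _ _) }
  where open Scattered sc

tough-criterion : ∀ G {n} → 2 ≤ n →
  (∀ S → Scattered G S 2 → n ≤ ∣ S ∣) →
  (∀ S → Scattered G S 3 → suc n ≤ ∣ S ∣) →
  (∀ S → ¬ Scattered G S 4) →
  Tough G (τ n)
tough-criterion G {n} n≥2 two three four S k ω≡k with numComponents⇒scattered ω≡k
... | sc with k
... | 0 = inj₁ z≤n
... | 1 = inj₁ (s≤s z≤n)
... | 2 = inj₂ (ℕ*τ≤ℕ⇐ 2 n ∣ S ∣ (begin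
  2 * suc n ≡⟨ ℕ.*-suc 2 n ⟩
  2 + 2 * n ≤⟨ ℕ.+-monoˡ-≤ (2 * n) n≥2 ⟩
  3 * n     ≤⟨ ℕ.*-monoʳ-≤ 3 (two S sc) ⟩
  3 * ∣ S ∣ ∎))
  where open ℕ.≤-Reasoning
... | 3 = inj₂ (ℕ*τ≤ℕ⇐ 3 n ∣ S ∣ (ℕ.*-monoʳ-≤ 3 (three S sc)))
... | suc (suc (suc (suc k))) = ⊥-elim (four S (scattered-≤ (s≤s (s≤s (s≤s (s≤s z≤n)))) sc))

components-¬tough : ∀ {G S k n} → 2 ≤ k → NumComponents G S k → 3 * ∣ S ∣ < k * suc n → ¬ Tough G (τ n)
components-¬tough {S = S} {k} {n} 2≤k ω≡k small tough with tough S k ω≡k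
... | inj₁ k≤1  = ℕ.<-irrefl refl (ℕ.≤-trans 2≤k k≤1)
... | inj₂ kτ≤s = ℕ.<-irrefl refl (ℕ.<-≤-trans small (ℕ*τ≤ℕ⇒ k n ∣ S ∣ kτ≤s))

components-¬tougher : ∀ {G S n} → NumComponents G S 3 → ∣ S ∣ ≤ suc n → ∀ t' → τ n <ℚ t' → ¬ Tough G t'
components-¬tougher {S = S} {n} ω≡3 ∣S∣≤ t' τ<t' tough with tough S 3 ω≡3
... | inj₁ (s≤s ())
... | inj₂ 3t'≤s = τ<⇒ℕ*≰ 2 n ∣ S ∣ τ<t' (ℕ.*-monoʳ-≤ 3 ∣S∣≤) 3t'≤s

_≗ᴬ_ : ∀ {M} → (Fin M → Fin M → Bool) → (Fin M → Fin M → Bool) → Set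
A ≗ᴬ A' = ∀ a b → A a b ≡ A' a b

reach-cong : ∀ {M} {A A' : Fin M → Fin M → Bool} {S} → A ≗ᴬ A' → ∀ {u v} → Reach (graph M A) S u v → Reach (graph M A') S u v
reach-cong A≗A' ε                     = ε
reach-cong A≗A' ((u∉S , v∉S , uv) ◅ r) = (u∉S , v∉S , trans (sym (A≗A' _ _)) uv) ◅ reach-cong A≗A' r

¬tough-cong : ∀ {M} {A A' : Fin M → Fin M → Bool} {t} → A ≗ᴬ A' → ¬ Tough (graph M A) t → ¬ Tough (graph M A') t
¬tough-cong A≗A' ¬tough tough' = ¬tough λ S k (c , surj , c≡⇔reach) → tough' S k (c , surj , λ u v u∉S v∉S →
  mk⇔ (reach-cong A≗A' ∘ Equivalence.to (c≡⇔reach u v u∉S v∉S))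
      (Equivalence.from (c≡⇔reach u v u∉S v∉S) ∘ reach-cong (λ a b → sym (A≗A' a b))))

removeEdge-comm : ∀ G u v → adj (removeEdge G u v) ≗ᴬ adj (removeEdge G v u)
removeEdge-comm G u v a b = cong (λ z → adj G a b ∧ not z) (∨-comm ((a == u) ∧ (b == v)) ((a == v) ∧ (b == u)))

deleteVertex : ∀ {M} → (Fin (suc M) → Fin (suc M) → Bool) → Fin (suc M) → Graph
deleteVertex {M} A w = graph M (λ x y → A (punchIn w x) (punchIn w y))

deleteVertex-removeEdge : ∀ {M} (A : Fin (suc M) → Fin (suc M) → Bool) w u v →
  adj (deleteVertex (adj (removeEdge (graph (suc M) A) (punchIn w u) (punchIn w v))) w)
    ≗ᴬ adj (removeEdge (deleteVertex A w) u v)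
deleteVertex-removeEdge A w u v a b rewrite ==-punchIn w a u | ==-punchIn w b v | ==-punchIn w a v | ==-punchIn w b u = refl

module DeletedVertex {M} (A : Fin (suc M) → Fin (suc M) → Bool) (w : Fin (suc M))
  (S : Subset (suc M)) (S₀ : Subset M) (w∈S : lookup S w ≡ true)
  (S₀≡S∘punchIn : ∀ x → lookup S₀ x ≡ lookup S (punchIn w x)) where

  H : Graph
  H = graph (suc M) A

  G : Graph
  G = deleteVertex A w

  ∣S∣≡1+∣S₀∣ : ∣ S ∣ ≡ suc ∣ S₀ ∣
  ∣S∣≡1+∣S₀∣ = begin
    ∣ S ∣                                   ≡⟨ ∣S∣≡count S ⟩
    count (lookup S)                        ≡⟨ count-remove w (lookup S) ⟩
    bit (lookup S w) + count (lookup S ∘ punchIn w) ≡⟨ cong₂ _+_ (cong bit w∈S) (count-cong (sym ∘ S₀≡S∘punchIn)) ⟩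
    suc (count (lookup S₀))                 ≡⟨ cong suc (∣S∣≡count S₀) ⟨
    suc ∣ S₀ ∣                              ∎
    where open ≡-Reasoning

  ∉S⇒∉S₀ : ∀ {x} → punchIn w x ∉ S → x ∉ S₀
  ∉S⇒∉S₀ {x} h = lookup⇒∉ S₀ (trans (S₀≡S∘punchIn x) (∉⇒lookup S h))

  ∉S₀⇒∉S : ∀ {x} → x ∉ S₀ → punchIn w x ∉ S
  ∉S₀⇒∉S {x} h = lookup⇒∉ S (trans (sym (S₀≡S∘punchIn x)) (∉⇒lookup S₀ h))

  ∉S⇒≢w : ∀ {v} → v ∉ S → w ≢ v
  ∉S⇒≢w v∉S refl with () ← trans (sym w∈S) (∉⇒lookup S v∉S)

  reach-lift : ∀ {x y} → Reach G S₀ x y → Reach H S (punchIn w x) (punchIn w y)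
  reach-lift ε                      = ε
  reach-lift ((x∉S₀ , y∉S₀ , xy) ◅ r) = (∉S₀⇒∉S x∉S₀ , ∉S₀⇒∉S y∉S₀ , xy) ◅ reach-lift r

  reach-drop : ∀ {a b} → Reach H S a b → ∀ {x y} → punchIn w x ≡ a → punchIn w y ≡ b → Reach G S₀ x y
  reach-drop ε {x} {y} refl wy≡wx = subst (Reach G S₀ x) (punchIn-injective w x y (sym wy≡wx)) ε
  reach-drop ((a∉S , c∉S , ac) ◅ r) {x} refl wy≡b =
    (∉S⇒∉S₀ a∉S , ∉S⇒∉S₀ (subst (_∉ S) (sym wz≡c) c∉S) , subst (λ c → A (punchIn w x) c ≡ true) (sym wz≡c) ac)
    ◅ reach-drop r wz≡c wy≡b
    where
    wz≡c = punchIn-punchOut (∉S⇒≢w c∉S)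

  numComponents-drop : ∀ {k} → NumComponents H S k → NumComponents G S₀ k
  numComponents-drop (c , surj , c≡⇔reach) =
    (λ x x∉S₀ → c (punchIn w x) (∉S₀⇒∉S x∉S₀)) , surj₀ , λ x y x∉S₀ y∉S₀ →
      mk⇔ (λ cx≡cy → reach-drop (Equivalence.to (c≡⇔reach _ _ (∉S₀⇒∉S x∉S₀) (∉S₀⇒∉S y∉S₀)) cx≡cy) refl refl)
          (Equivalence.from (c≡⇔reach _ _ (∉S₀⇒∉S x∉S₀) (∉S₀⇒∉S y∉S₀)) ∘ reach-lift)
    where
    surj₀ : ∀ i → ∃ λ x → Σ (x ∉ S₀) λ x∉S₀ → c (punchIn w x) (∉S₀⇒∉S x∉S₀) ≡ i
    -- c ignores its proof argument: both labels below belong to v, which reaches itself.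
    surj₀ i = punchOut w≢v , x∉S₀ , trans (Equivalence.from (c≡⇔reach _ _ (∉S₀⇒∉S x∉S₀) v∉S) (subst (Reach H S _) wx≡v ε)) cv≡i
      where
      v = proj₁ (surj i)
      v∉S = proj₁ (proj₂ (surj i))
      cv≡i = proj₂ (proj₂ (surj i))
      w≢v = ∉S⇒≢w v∉S
      wx≡v = punchIn-punchOut w≢v
      x∉S₀ = ∉S⇒∉S₀ (subst (_∉ S) (sym wx≡v) v∉S)

  scattered-lift : ∀ {k} → Scattered G S₀ k → Scattered H S k
  scattered-lift sc = record
    { pick   = punchIn w ∘ pick
    ; pick∉S = ∉S₀⇒∉S ∘ pick∉S
    ; apart  = λ l≢l' r → apart l≢l' (reach-drop r refl refl) }
    where open Scattered sc

row : ∀ {n} → Fin (3 * n) → Fin 3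
row {n} x = proj₁ (remQuot {3} n x)

col : ∀ {n} → Fin (3 * n) → Fin n
col {n} x = proj₂ (remQuot {3} n x)

vtx-row-col : ∀ {n} (x : Fin (3 * n)) → vtx (row {n} x) (col x) ≡ x
vtx-row-col {n} = combine-remQuot {3} n

∀-vtx : ∀ {n} (P : Fin (3 * n) → Set) → (∀ i (q : Fin n) → P (vtx i q)) → ∀ u → P u
∀-vtx {n} P P-vtx u = subst P (vtx-row-col {n} u) (P-vtx (row {n} u) (col u))

∀-vtx² : ∀ {n} (P : Fin (3 * n) → Fin (3 * n) → Set) → (∀ i (q : Fin n) j (r : Fin n) → P (vtx i q) (vtx j r)) → ∀ u v → P u v
∀-vtx² {n} P P-vtx u = ∀-vtx (P u) (∀-vtx (λ u → ∀ i (q : Fin n) → P u (vtx i q)) P-vtx u)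

adjKP-vtx : ∀ n (i : Fin 3) (q : Fin n) j r →
  adjKP n (vtx i q) (vtx j r) ≡ ((i == j ∧ not (q == r)) ∨ (q == r ∧ adjP3 i j))
adjKP-vtx n i q j r = cong₂ adjacent (remQuot-combine {3} {n} i q) (remQuot-combine {3} {n} j r)
  where
  adjacent : Fin 3 × Fin n → Fin 3 × Fin n → Bool
  adjacent (i , q) (j , r) = (i == j ∧ not (q == r)) ∨ (q == r ∧ adjP3 i j)

adjP3-sym : ∀ i j → adjP3 i j ≡ adjP3 j i
adjP3-sym 0F 0F = refl
adjP3-sym 0F 1F = refl
adjP3-sym 0F 2F = refl
adjP3-sym 1F 0F = refl
adjP3-sym 1F 1F = refl
adjP3-sym 1F 2F = refl
adjP3-sym 2F 0F = refl
adjP3-sym 2F 1F = refl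
adjP3-sym 2F 2F = refl

adjP3-1F : ∀ j → j ≢ 1F → adjP3 1F j ≡ true
adjP3-1F 0F _   = refl
adjP3-1F 1F 1≢1 = ⊥-elim (1≢1 refl)
adjP3-1F 2F _   = refl

adjKP-sym : ∀ n u v → adjKP n u v ≡ adjKP n v u
adjKP-sym n = ∀-vtx² (λ u v → adjKP n u v ≡ adjKP n v u) sym-vtx
  where
  open ≡-Reasoning
  sym-vtx : ∀ i (q : Fin n) j r → adjKP n (vtx i q) (vtx j r) ≡ adjKP n (vtx j r) (vtx i q)
  sym-vtx i q j r = begin
    adjKP n (vtx i q) (vtx j r)                       ≡⟨ adjKP-vtx n i q j r ⟩
    (i == j ∧ not (q == r)) ∨ (q == r ∧ adjP3 i j)    ≡⟨ cong₂ _∨_ (cong₂ _∧_ (==-sym i j) (cong not (==-sym q r)))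
                                                                   (cong₂ _∧_ (==-sym q r) (adjP3-sym i j)) ⟩
    (j == i ∧ not (r == q)) ∨ (r == q ∧ adjP3 j i)    ≡⟨ adjKP-vtx n j r i q ⟨
    adjKP n (vtx j r) (vtx i q)                       ∎

adjKP-row : ∀ n i {q r : Fin n} → q ≢ r → adjKP n (vtx i q) (vtx i r) ≡ true
adjKP-row n i {q} {r} q≢r rewrite adjKP-vtx n i q i r | ==-refl i | ==-≢ q≢r = refl

adjKP-col : ∀ n {i j} (q : Fin n) → adjP3 i j ≡ true → adjKP n (vtx i q) (vtx j q) ≡ true
adjKP-col n {i} {j} q ij rewrite adjKP-vtx n i q j q | ==-refl q | ij = ∨-zeroʳ _

adjKP-symmetric : ∀ n → Symmetric (KnP3 n)
adjKP-symmetric n u v uv = trans (adjKP-sym n v u) uv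

adjKP-edge : ∀ n i (q : Fin n) j r → adjKP n (vtx i q) (vtx j r) ≡ true → (i ≡ j × q ≢ r) ⊎ (q ≡ r × adjP3 i j ≡ true)
adjKP-edge n i q j r uv = classify (trans (sym (adjKP-vtx n i q j r)) uv)
  where
  classify : ((i == j ∧ not (q == r)) ∨ (q == r ∧ adjP3 i j)) ≡ true → (i ≡ j × q ≢ r) ⊎ (q ≡ r × adjP3 i j ≡ true)
  classify h with i ≟ j | q ≟ r
  ... | yes i≡j | no q≢r  = inj₁ (i≡j , q≢r)
  ... | yes _   | yes q≡r = inj₂ (q≡r , h)
  ... | no _    | yes q≡r = inj₂ (q≡r , h)

adjP3-edge : ∀ i j → adjP3 i j ≡ true → (i ≢ 1F × j ≡ 1F) ⊎ (i ≡ 1F × j ≢ 1F)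
adjP3-edge 0F 1F _ = inj₁ ((λ ()) , refl)
adjP3-edge 1F 0F _ = inj₂ (refl , (λ ()))
adjP3-edge 1F 2F _ = inj₂ (refl , (λ ()))
adjP3-edge 2F 1F _ = inj₁ ((λ ()) , refl)

isShortcut : ∀ n → Fin n → Fin (3 * n) → Fin (3 * n) → Bool
isShortcut n p a b = (a == vtx 0F p ∧ b == vtx 2F p) ∨ (a == vtx 2F p ∧ b == vtx 0F p)

-- H = K_n □ P_3 plus the edge (0,p)(2,p); G₀ n p is definitionally deleteVertex (adjH n p) (vtx 1F p).
adjH : ∀ n → Fin n → Fin (3 * n) → Fin (3 * n) → Bool
adjH n p a b = adjKP n a b ∨ isShortcut n p a b

adjH-row : ∀ n p i {q r : Fin n} → q ≢ r → adjH n p (vtx i q) (vtx i r) ≡ true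
adjH-row n p i q≢r = ∨-introˡ _ (adjKP-row n i q≢r)

adjH-col : ∀ n p {i j} (q : Fin n) → adjP3 i j ≡ true → adjH n p (vtx i q) (vtx j q) ≡ true
adjH-col n p q ij = ∨-introˡ _ (adjKP-col n q ij)

adjH-shortcut : ∀ n p → adjH n p (vtx 0F p) (vtx 2F p) ≡ true
adjH-shortcut n p = trans (cong (adjKP n (vtx 0F p) (vtx 2F p) ∨_) shortcut) (∨-zeroʳ _)
  where
  shortcut : isShortcut n p (vtx 0F p) (vtx 2F p) ≡ true
  shortcut rewrite ==-refl (vtx {n} 0F p) | ==-refl (vtx {n} 2F p) = refl

adjH-symmetric : ∀ n p → Symmetric (graph (3 * n) (adjH n p))
adjH-symmetric n p u v uv = trans (cong₂ _∨_ (adjKP-sym n v u) (shortcut-sym v u)) uv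
  where
  shortcut-sym : ∀ a b → isShortcut n p a b ≡ isShortcut n p b a
  shortcut-sym a b = trans (∨-comm ((a == vtx 0F p) ∧ (b == vtx 2F p)) _)
    (cong₂ _∨_ (∧-comm (a == vtx 2F p) (b == vtx 0F p)) (∧-comm (a == vtx 0F p) (b == vtx 2F p)))

==-vtx : ∀ {n} {i i₀ : Fin 3} {q p : Fin n} → (vtx i q == vtx i₀ p) ≡ true → i ≡ i₀ × q ≡ p
==-vtx {i = i} {i₀} {q} {p} h = let h' = trans (sym (==-combine i i₀ q p)) h in ==⇒≡ (∧-trueˡ h') , ==⇒≡ (∧-trueʳ {i == i₀} h')

isShortcut-vtx : ∀ n p i (q : Fin n) j r → isShortcut n p (vtx i q) (vtx j r) ≡ true →
  (i ≡ 0F × j ≡ 2F × q ≡ p × r ≡ p) ⊎ (i ≡ 2F × j ≡ 0F × q ≡ p × r ≡ p)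
isShortcut-vtx n p i q j r uv with ∨-cases ((vtx i q == vtx 0F p) ∧ (vtx j r == vtx 2F p)) uv
... | inj₁ h = let i≡0 , q≡p = ==-vtx (∧-trueˡ h) ; j≡2 , r≡p = ==-vtx (∧-trueʳ {vtx i q == vtx 0F p} h)
               in inj₁ (i≡0 , j≡2 , q≡p , r≡p)
... | inj₂ h = let i≡2 , q≡p = ==-vtx (∧-trueˡ h) ; j≡0 , r≡p = ==-vtx (∧-trueʳ {vtx i q == vtx 2F p} h)
               in inj₂ (i≡2 , j≡0 , q≡p , r≡p)

module GridBounds {n} (A : Fin (3 * n) → Fin (3 * n) → Bool)
  (A-row : ∀ i {q r : Fin n} → q ≢ r → A (vtx i q) (vtx i r) ≡ true)
  (A-col : ∀ {i j} (q : Fin n) → adjP3 i j ≡ true → A (vtx i q) (vtx j q) ≡ true)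
  (A-sym : Symmetric (graph (3 * n) A))
  (S : Subset (3 * n)) where

  G : Graph
  G = graph (3 * n) A

  σ : Fin 3 → Fin n → Bool
  σ i q = lookup S (vtx i q)

  weight : Fin n → ℕ
  weight q = count (λ i → σ i q)

  ∣S∣≡sum-weight : ∣ S ∣ ≡ sum weight
  ∣S∣≡sum-weight = trans (∣S∣≡count S) (trans (sum-combine 3 {n} (bit ∘ lookup S)) (∑-comm (λ i q → bit (σ i q))))

  ∉S : ∀ i q → σ i q ≡ false → vtx i q ∉ S
  ∉S i q = lookup⇒∉ S

  along-row : ∀ i q r → vtx i q ∉ S → vtx i r ∉ S → Reach G S (vtx i q) (vtx i r)
  along-row i q r q∉S r∉S with q ≟ r
  ... | yes refl = ε
  ... | no q≢r   = (q∉S , r∉S , A-row i q≢r) ◅ ε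

  along-col : ∀ i j q → adjP3 i j ≡ true → vtx i q ∉ S → vtx j q ∉ S → Reach G S (vtx i q) (vtx j q)
  along-col i j q ij i∉S j∉S = (i∉S , j∉S , A-col q ij) ◅ ε

  free-column-connects : ∀ q → (∀ i → σ i q ≡ false) → ∀ i a j b → vtx i a ∉ S → vtx j b ∉ S →
    Reach G S (vtx i a) (vtx j b)
  free-column-connects q free i a j b a∉S b∉S =
    along-row i a q a∉S (free∉S i) ◅◅ to-mid i ◅◅ Reach-sym A-sym (to-mid j) ◅◅ along-row j q b (free∉S j) b∉S
    where
    free∉S : ∀ i → vtx i q ∉ S
    free∉S i = ∉S i q (free i)
    to-mid : ∀ i → Reach G S (vtx i q) (vtx 1F q)
    to-mid 0F = along-col 0F 1F q refl (free∉S 0F) (free∉S 1F)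
    to-mid 1F = ε
    to-mid 2F = along-col 2F 1F q refl (free∉S 2F) (free∉S 1F)

  blocked : ∀ i j a {y} → adjP3 i j ≡ true → vtx i a ∉ S → ¬ Reach G S (vtx i a) y →
    (vtx j a ∉ S → Reach G S (vtx j a) y) → σ j a ≡ true
  blocked i j a ij i∉S ¬reach j-reach with σ j a in σja
  ... | true  = refl
  ... | false = ⊥-elim (¬reach (along-col i j a ij i∉S (∉S j a σja) ◅◅ j-reach (∉S j a σja)))

  module Picks {k} (sc : Scattered G S k) where
    open Scattered sc

    r : Fin k → Fin 3
    r l = row {n} (pick l)

    c : Fin k → Fin n
    c l = col (pick l)

    at∉S : ∀ l → vtx (r l) (c l) ∉ S
    at∉S l = subst (_∉ S) (sym (vtx-row-col {n} (pick l))) (pick∉S l)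

    apart-at : ∀ {l l'} → l ≢ l' → ¬ Reach G S (vtx (r l) (c l)) (vtx (r l') (c l'))
    apart-at {l} {l'} l≢l' = subst₂ (λ x y → ¬ Reach G S x y)
      (sym (vtx-row-col {n} (pick l))) (sym (vtx-row-col {n} (pick l'))) (apart l≢l')

    rows-injective : Injective _≡_ _≡_ r
    rows-injective {l} {l'} rl≡rl' with l ≟ l'
    ... | yes l≡l' = l≡l'
    ... | no l≢l'  = ⊥-elim (apart-at l≢l' (subst (λ i → Reach G S (vtx (r l) (c l)) (vtx i (c l'))) rl≡rl'
      (along-row (r l) (c l) (c l') (at∉S l) (subst (λ i → vtx i (c l') ∉ S) (sym rl≡rl') (at∉S l')))))

  ¬scattered₄ : ¬ Scattered G S 4
  ¬scattered₄ sc = <⇒≢ i<j (rows-injective ri≡rj)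
    where
    open Picks sc
    collision = pigeonhole (ℕ.n<1+n 3) r
    i<j = proj₁ (proj₂ (proj₂ collision))
    ri≡rj = proj₂ (proj₂ (proj₂ collision))

  scattered₂⇒meets : Scattered G S 2 → ∀ q → 1 ≤ weight q
  scattered₂⇒meets sc q with σ 0F q in σ₀ | σ 1F q in σ₁ | σ 2F q in σ₂
  ... | true  | _     | _     = s≤s z≤n
  ... | false | true  | _     = s≤s z≤n
  ... | false | false | true  = s≤s z≤n
  ... | false | false | false =
    ⊥-elim (apart-at {0F} {1F} (λ ()) (free-column-connects q free (r 0F) (c 0F) (r 1F) (c 1F) (at∉S 0F) (at∉S 1F)))
    where
    open Picks sc
    free : ∀ i → σ i q ≡ false
    free 0F = σ₀
    free 1F = σ₁
    free 2F = σ₂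

  lower₂ : Scattered G S 2 → n ≤ ∣ S ∣
  lower₂ sc = subst (n ≤_) (sym ∣S∣≡sum-weight) (sum-≥n weight (scattered₂⇒meets sc))

  -- Three components occupy the three rows, so one of them lies in the middle row.
  module Picks₃ (sc : Scattered G S 3) where
    open Picks sc public

    middle : Fin 3
    middle = proj₁ (injective⇒surjective r rows-injective 1F)

    r-middle : r middle ≡ 1F
    r-middle = proj₂ (injective⇒surjective r rows-injective 1F)

    outer : Fin 2 → Fin 3
    outer = punchIn middle

    outer-row : ∀ x → r (outer x) ≢ 1F
    outer-row x ro≡1 = punchInᵢ≢i middle x (rows-injective (trans ro≡1 (sym r-middle)))

    outer-distinct : outer 0F ≢ outer 1F
    outer-distinct o₀≡o₁ with () ← punchIn-injective middle 0F 1F o₀≡o₁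

    outer-rows-distinct : r (outer 0F) ≢ r (outer 1F)
    outer-rows-distinct = outer-distinct ∘ rows-injective

    middle≢outer : ∀ x → middle ≢ outer x
    middle≢outer x = punchInᵢ≢i middle x ∘ sym

    middle-adj-outer : ∀ x → adjP3 (r middle) (r (outer x)) ≡ true
    middle-adj-outer x = subst (λ i → adjP3 i (r (outer x)) ≡ true) (sym r-middle) (adjP3-1F _ (outer-row x))

    middle-column-∉S : σ 1F (c middle) ≡ false
    middle-column-∉S = subst (λ i → σ i (c middle) ≡ false) r-middle (∉⇒lookup S (at∉S middle))

    -- The middle component is separated from an outer one only if that outer row is cut in its column.
    middle-column-heavy : 2 ≤ weight (c middle)
    middle-column-heavy = count-≥2 (λ i → σ i (c middle)) outer-rows-distinct (outer-cut 0F) (outer-cut 1F)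
      where
      outer-cut : ∀ x → σ (r (outer x)) (c middle) ≡ true
      outer-cut x = blocked (r middle) (r (outer x)) (c middle) (middle-adj-outer x) (at∉S middle)
        (apart-at (middle≢outer x)) (λ j∉S → along-row (r (outer x)) (c middle) (c (outer x)) j∉S (at∉S (outer x)))

  lower₃ : Scattered G S 3 → suc n ≤ ∣ S ∣
  lower₃ sc = subst (suc n ≤_) (sym ∣S∣≡sum-weight)
    (sum-≥1+n weight (scattered₂⇒meets (scattered-≤ (s≤s (s≤s z≤n)) sc)) middle-column-heavy)
    where open Picks₃ sc

  -- With the extra edge (0,p)(2,p) and (1,p) ∈ S, one more vertex of S is forced.
  module Shortcut (p : Fin n) (A-short : A (vtx 0F p) (vtx 2F p) ≡ true) (σ₁ₚ : σ 1F p ≡ true) where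

    shortcut-heavy-or-open : 2 ≤ weight p ⊎ (σ 0F p ≡ false × σ 2F p ≡ false)
    shortcut-heavy-or-open = cases (σ 0F p) (σ 2F p) refl refl
      where
      cases : ∀ b₀ b₂ → σ 0F p ≡ b₀ → σ 2F p ≡ b₂ → 2 ≤ weight p ⊎ (σ 0F p ≡ false × σ 2F p ≡ false)
      cases true  _     σ₀ₚ _   = inj₁ (count-≥2 (λ i → σ i p) {0F} {1F} (λ ()) σ₀ₚ σ₁ₚ)
      cases false true  _   σ₂ₚ = inj₁ (count-≥2 (λ i → σ i p) {2F} {1F} (λ ()) σ₂ₚ σ₁ₚ)
      cases false false σ₀ₚ σ₂ₚ = inj₂ (σ₀ₚ , σ₂ₚ)

    module Open (σ₀ₚ : σ 0F p ≡ false) (σ₂ₚ : σ 2F p ≡ false) where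

      to-shortcut : ∀ i (a : Fin n) → i ≢ 1F → vtx i a ∉ S → Reach G S (vtx i a) (vtx 0F p)
      to-shortcut 0F a _   a∉S = along-row 0F a p a∉S (∉S 0F p σ₀ₚ)
      to-shortcut 1F a 1≢1 _   = ⊥-elim (1≢1 refl)
      to-shortcut 2F a _   a∉S = along-row 2F a p a∉S (∉S 2F p σ₂ₚ) ◅◅ ((∉S 2F p σ₂ₚ , ∉S 0F p σ₀ₚ , A-sym _ _ A-short) ◅ ε)

      module _ {k} (sc : Scattered G S k) where
        open Picks sc

        outer-picks-linked : ∀ {l l'} → r l ≢ 1F → r l' ≢ 1F → Reach G S (vtx (r l) (c l)) (vtx (r l') (c l'))
        outer-picks-linked {l} {l'} rl≢1 rl'≢1 =
          to-shortcut (r l) (c l) rl≢1 (at∉S l) ◅◅ Reach-sym A-sym (to-shortcut (r l') (c l') rl'≢1 (at∉S l'))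

        middle-pick-heavy : ∀ {l l'} → l ≢ l' → r l ≡ 1F → 2 ≤ weight (c l)
        middle-pick-heavy {l} {l'} l≢l' rl≡1 = count-≥2 (λ i → σ i (c l)) {0F} {2F} (λ ()) (cut 0F (λ ())) (cut 2F (λ ()))
          where
          rl'≢1 : r l' ≢ 1F
          rl'≢1 rl'≡1 = l≢l' (rows-injective (trans rl≡1 (sym rl'≡1)))
          cut : ∀ j → j ≢ 1F → σ j (c l) ≡ true
          cut j j≢1 = blocked (r l) j (c l) (subst (λ i → adjP3 i j ≡ true) (sym rl≡1) (adjP3-1F j j≢1))
            (at∉S l) (apart-at l≢l')
            (λ j∉S → to-shortcut j (c l) j≢1 j∉S ◅◅ Reach-sym A-sym (to-shortcut (r l') (c l') rl'≢1 (at∉S l')))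

    scattered₂⇒heavy : Scattered G S 2 → ∃ λ q → 2 ≤ weight q
    scattered₂⇒heavy sc with shortcut-heavy-or-open
    ... | inj₁ p-heavy = p , p-heavy
    ... | inj₂ (σ₀ₚ , σ₂ₚ) with Picks.r sc 0F ≟ 1F | Picks.r sc 1F ≟ 1F
    ...   | yes r₀≡1 | _        = Picks.c sc 0F , Open.middle-pick-heavy σ₀ₚ σ₂ₚ sc {0F} {1F} (λ ()) r₀≡1
    ...   | no _     | yes r₁≡1 = Picks.c sc 1F , Open.middle-pick-heavy σ₀ₚ σ₂ₚ sc {1F} {0F} (λ ()) r₁≡1
    ...   | no r₀≢1  | no r₁≢1  = ⊥-elim (Picks.apart-at sc {0F} {1F} (λ ()) (Open.outer-picks-linked σ₀ₚ σ₂ₚ sc r₀≢1 r₁≢1))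

    lower₂ₛ : Scattered G S 2 → suc n ≤ ∣ S ∣
    lower₂ₛ sc = subst (suc n ≤_) (sym ∣S∣≡sum-weight)
      (sum-≥1+n weight (scattered₂⇒meets sc) (proj₂ (scattered₂⇒heavy sc)))

    lower₃ₛ : Scattered G S 3 → suc (suc n) ≤ ∣ S ∣
    lower₃ₛ sc = subst (suc (suc n) ≤_) (sym ∣S∣≡sum-weight)
      (sum-≥2+n weight (scattered₂⇒meets (scattered-≤ (s≤s (s≤s z≤n)) sc)) p≢middle p-heavy middle-column-heavy)
      where
      open Picks₃ sc
      p≢middle : p ≢ c middle
      p≢middle refl with () ← trans (sym σ₁ₚ) middle-column-∉S
      p-heavy : 2 ≤ weight p
      p-heavy with shortcut-heavy-or-open
      ... | inj₁ heavy = heavy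
      ... | inj₂ (σ₀ₚ , σ₂ₚ) =
        ⊥-elim (apart-at outer-distinct (Open.outer-picks-linked σ₀ₚ σ₂ₚ sc (outer-row 0F) (outer-row 1F)))

-- An adjacency between (row, column type) pairs, also told whether the two columns coincide.
TypedEdges : ℕ → Set
TypedEdges m = Fin 3 → Maybe (Fin m) → Fin 3 → Maybe (Fin m) → Bool → Bool

-- A route step inside G ∖ S: to another row in the same column, or along the row to the
-- (representative) column of a given type.
data Move (m : ℕ) : Set where
  vertical   : Fin 3 → Move m
  horizontal : Maybe (Fin m) → Move m

-- Whether columns of types t and t' can be equal (e = true) or different (e = false).
consistent : ∀ {m} → Maybe (Fin m) → Maybe (Fin m) → Bool → Bool
consistent t t' e = (t ==ᵗ t' ∨ not e) ∧ (not (t ==ᵗ t') ∨ (e ∨ is-nothing t))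

-- A graph on Fin 3 × Fin n, a cut S and a labelling of the components of G ∖ S, all
-- described through the type of a column with respect to m distinguished columns.
record Certificate (m k : ℕ) : Set where
  field
    edgeᵗ       : TypedEdges m
    cutᵗ        : Fin 3 → Maybe (Fin m) → Bool
    labelᵗ      : Fin 3 → Maybe (Fin m) → Fin k
    rootRow     : Fin k → Fin 3
    rootType    : Fin k → Maybe (Fin m)
    route       : Fin 3 → Maybe (Fin m) → List (Move m)
    othersExist : Bool

module Check {m k} (W : Certificate m k) where
  open Certificate W

  allPairs : TypedEdges m → Bool
  allPairs F = allFin λ i → allType λ t → allFin λ j → allType λ t' → allBool (F i t j t')

  allPairs-sound : ∀ F → allPairs F ≡ true → ∀ i t j t' e → F i t j t' e ≡ true
  allPairs-sound F h i t j t' = allBool-sound (F i t j t')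
    (allType-sound (λ t' → allBool (F i t j t')) (allFin-sound (λ j → allType λ t' → allBool (F i t j t'))
      (allType-sound (λ t → allFin λ j → allType λ t' → allBool (F i t j t'))
        (allFin-sound (λ i → allType λ t → allFin λ j → allType λ t' → allBool (F i t j t')) h i) t) j) t')

  labels-respect-edges : TypedEdges m
  labels-respect-edges i t j t' e =
    not (consistent t t' e) ∨ (cutᵗ i t ∨ (cutᵗ j t' ∨ (not (edgeᵗ i t j t' e) ∨ (labelᵗ i t == labelᵗ j t'))))

  edges-symmetric : TypedEdges m
  edges-symmetric i t j t' e = not (consistent t t' e) ∨ (not (edgeᵗ i t j t' e) ∨ edgeᵗ j t' i t e)

  move-ok : Fin 3 → Maybe (Fin m) → Move m → Bool
  move-ok i t (vertical j)    = not (cutᵗ j t) ∧ edgeᵗ i t j t true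
  move-ok i t (horizontal t') =
    not (cutᵗ i t') ∧ ((is-just t' ∨ othersExist) ∧ ((t ==ᵗ t' ∧ is-just t') ∨ edgeᵗ i t i t' false))

  nextRow : Fin 3 → Move m → Fin 3
  nextRow i (vertical j)   = j
  nextRow i (horizontal _) = i

  nextType : Maybe (Fin m) → Move m → Maybe (Fin m)
  nextType t (vertical _)    = t
  nextType t (horizontal t') = t'

  walk-ok : Fin 3 → Maybe (Fin m) → List (Move m) → Bool
  walk-ok i t []        = true
  walk-ok i t (mv ∷ ms) = move-ok i t mv ∧ walk-ok (nextRow i mv) (nextType t mv) ms

  endRow : Fin 3 → Maybe (Fin m) → List (Move m) → Fin 3
  endRow i t []        = i
  endRow i t (mv ∷ ms) = endRow (nextRow i mv) (nextType t mv) ms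

  endType : Fin 3 → Maybe (Fin m) → List (Move m) → Maybe (Fin m)
  endType i t []        = t
  endType i t (mv ∷ ms) = endType (nextRow i mv) (nextType t mv) ms

  route-ok : Fin 3 → Maybe (Fin m) → Bool
  route-ok i t = cutᵗ i t ∨ (walk-ok i t ms ∧ (move-ok (endRow i t ms) (endType i t ms) (horizontal (rootType l))
                                              ∧ (endRow i t ms == rootRow l)))
    where
    ms = route i t
    l  = labelᵗ i t

  root-ok : Fin k → Bool
  root-ok l =
    not (cutᵗ (rootRow l) (rootType l)) ∧ ((labelᵗ (rootRow l) (rootType l) == l) ∧ (is-just (rootType l) ∨ othersExist))

  valid : Bool
  valid = allPairs labels-respect-edges ∧ (allPairs edges-symmetric ∧ (allFin (λ i → allType (route-ok i)) ∧ allFin root-ok))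

record Realisation {m k} (W : Certificate m k) (n : ℕ) : Set where
  open Certificate W
  field
    d           : Fin m → Fin n
    d-injective : Injective _≡_ _≡_ d
    other       : Fin n
    other-type  : othersExist ≡ true → typeOf d other ≡ nothing
    A           : Fin (3 * n) → Fin (3 * n) → Bool
    A-type      : ∀ i q j r → A (vtx i q) (vtx j r) ≡ edgeᵗ i (typeOf d q) j (typeOf d r) (q == r)

cutCoefficient : ∀ {m k} → Certificate m k → ℕ
cutCoefficient W = sum (λ i → bit (cutᵗ i nothing))
  where open Certificate W

cutConstant : ∀ {m k} → Certificate m k → ℕ
cutConstant W = sum (λ i → sum (bit ∘ cutᵗ i ∘ just))
  where open Certificate W

-- |S| when c columns are undistinguished
cutSize : ∀ {m k} → Certificate m k → ℕ → ℕ
cutSize W c = cutCoefficient W * c + cutConstant W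

module Soundness {m k} (W : Certificate m k) (W-valid : Check.valid W ≡ true) {n} (R : Realisation W n) where
  open Certificate W
  open Check W
  open Realisation R

  G : Graph
  G = graph (3 * n) A

  cut : Fin (3 * n) → Bool
  cut x = cutᵗ (row {n} x) (typeOf d (col x))

  S : Subset (3 * n)
  S = tabulate cut

  label : Fin (3 * n) → Fin k
  label x = labelᵗ (row {n} x) (typeOf d (col x))

  cut-vtx : ∀ i q → cut (vtx i q) ≡ cutᵗ i (typeOf d q)
  cut-vtx i q = cong (λ (i , q) → cutᵗ i (typeOf d q)) (remQuot-combine {3} {n} i q)

  label-vtx : ∀ i q → label (vtx i q) ≡ labelᵗ i (typeOf d q)
  label-vtx i q = cong (λ (i , q) → labelᵗ i (typeOf d q)) (remQuot-combine {3} {n} i q)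

  vtx∉S : ∀ i q → cutᵗ i (typeOf d q) ≡ false → vtx i q ∉ S
  vtx∉S i q h = lookup⇒∉ S (trans (lookup∘tabulate cut (vtx i q)) (trans (cut-vtx i q) h))

  ∉S⇒uncut : ∀ i q → vtx i q ∉ S → cutᵗ i (typeOf d q) ≡ false
  ∉S⇒uncut i q h = trans (sym (cut-vtx i q)) (trans (sym (lookup∘tabulate cut (vtx i q))) (∉⇒lookup S h))

  private
    labels-ok : allPairs labels-respect-edges ≡ true
    labels-ok = ∧-trueˡ W-valid
    symmetric-ok : allPairs edges-symmetric ≡ true
    symmetric-ok = ∧-trueˡ (∧-trueʳ {allPairs labels-respect-edges} W-valid)
    routes-ok : ∀ i t → route-ok i t ≡ true
    routes-ok i = allType-sound (route-ok i) (allFin-sound (λ i → allType (route-ok i))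
      (∧-trueˡ (∧-trueʳ {allPairs edges-symmetric} (∧-trueʳ {allPairs labels-respect-edges} W-valid))) i)
    roots-ok : ∀ l → root-ok l ≡ true
    roots-ok = allFin-sound root-ok
      (∧-trueʳ {allFin (λ i → allType (route-ok i))}
        (∧-trueʳ {allPairs edges-symmetric} (∧-trueʳ {allPairs labels-respect-edges} W-valid)))

  consistent-typeOf : ∀ q r → consistent (typeOf d q) (typeOf d r) (q == r) ≡ true
  consistent-typeOf q r with q ≟ r
  ... | yes refl rewrite ==ᵗ-refl (typeOf d q) = refl
  ... | no q≢r with typeOf d q ==ᵗ typeOf d r in same
  ... | false = refl
  ... | true with typeOf d q in tq
  ... | nothing = refl
  ... | just l  = ⊥-elim (q≢r (trans (typeOf-just d q l tq) (sym (typeOf-just d r l (sym (==ᵗ⇒≡ same))))))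

  edge-reversed : ∀ i q j r → A (vtx i q) (vtx j r) ≡ true → edgeᵗ j (typeOf d r) i (typeOf d q) (q == r) ≡ true
  edge-reversed i q j r qr = ∨-trueʳ
    (∨-trueʳ (allPairs-sound edges-symmetric symmetric-ok i (typeOf d q) j (typeOf d r) (q == r))
             (cong not (consistent-typeOf q r)))
    (cong not (trans (sym (A-type i q j r)) qr))

  A-symmetric : Symmetric G
  A-symmetric = ∀-vtx² (λ u v → A u v ≡ true → A v u ≡ true) λ i q j r qr → begin
    A (vtx j r) (vtx i q)                        ≡⟨ A-type j r i q ⟩
    edgeᵗ j (typeOf d r) i (typeOf d q) (r == q) ≡⟨ cong (edgeᵗ j (typeOf d r) i (typeOf d q)) (==-sym r q) ⟩
    edgeᵗ j (typeOf d r) i (typeOf d q) (q == r) ≡⟨ edge-reversed i q j r qr ⟩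
    true                                         ∎
    where open ≡-Reasoning

  label-step : ∀ {u v} → Step G S u v → label u ≡ label v
  label-step {u} {v} = ∀-vtx² (λ u v → Step G S u v → label u ≡ label v) step-vtx u v
    where
    step-vtx : ∀ i q j r → Step G S (vtx i q) (vtx j r) → label (vtx i q) ≡ label (vtx j r)
    step-vtx i q j r (q∉S , r∉S , qr) = trans (label-vtx i q) (trans (==⇒≡ same-label) (sym (label-vtx j r)))
      where
      same-label = ∨-trueʳ (∨-trueʳ (∨-trueʳ (∨-trueʳ
        (allPairs-sound labels-respect-edges labels-ok i (typeOf d q) j (typeOf d r) (q == r))
        (cong not (consistent-typeOf q r))) (∉S⇒uncut i q q∉S)) (∉S⇒uncut j r r∉S))
        (cong not (trans (sym (A-type i q j r)) qr))

  rep : Maybe (Fin m) → Fin n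
  rep nothing  = other
  rep (just l) = d l

  typeOf-rep : ∀ t → (is-just t ∨ othersExist) ≡ true → typeOf d (rep t) ≡ t
  typeOf-rep nothing  h = other-type h
  typeOf-rep (just l) _ = typeOf-d d d-injective l

  not-at-rep : ∀ q t → q ≢ rep t → (typeOf d q ==ᵗ t ∧ is-just t) ≡ false
  not-at-rep q nothing  _ = ∧-zeroʳ (typeOf d q ==ᵗ nothing)
  not-at-rep q (just l) q≢dl with typeOf d q ==ᵗ just l in same
  ... | false = refl
  ... | true  = ⊥-elim (q≢dl (typeOf-just d q l (==ᵗ⇒≡ same)))

  move-sound : ∀ i q t mv → typeOf d q ≡ t → cutᵗ i t ≡ false → move-ok i t mv ≡ true →
    Σ (Fin n) λ q' → typeOf d q' ≡ nextType t mv × Reach G S (vtx i q) (vtx (nextRow i mv) q')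
                     × (∀ t' → mv ≡ horizontal t' → q' ≡ rep t')
  move-sound i q t (vertical j) refl uncut ok =
    q , refl , (vtx∉S i q uncut , vtx∉S j q (not-true (∧-trueˡ ok)) , edge) ◅ ε , λ _ ()
    where
    edge : A (vtx i q) (vtx j q) ≡ true
    edge = trans (A-type i q j q)
      (trans (cong (edgeᵗ i (typeOf d q) j (typeOf d q)) (==-refl q)) (∧-trueʳ {not (cutᵗ j (typeOf d q))} ok))
  move-sound i q t (horizontal t') refl uncut ok with q ≟ rep t'
  ... | yes refl = rep t' , typeOf-rep t' realised , ε , λ { _ refl → refl }
    where realised = ∧-trueˡ (∧-trueʳ {not (cutᵗ i t')} ok)
  ... | no q≢rep = rep t' , typeOf-rep t' realised , (vtx∉S i q uncut , rep∉S , edge) ◅ ε , λ { _ refl → refl }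
    where
    realised = ∧-trueˡ (∧-trueʳ {not (cutᵗ i t')} ok)
    rep∉S = vtx∉S i (rep t') (subst (λ t → cutᵗ i t ≡ false) (sym (typeOf-rep t' realised)) (not-true (∧-trueˡ ok)))
    edge : A (vtx i q) (vtx i (rep t')) ≡ true
    edge = trans (A-type i q i (rep t')) (trans (cong₂ (edgeᵗ i (typeOf d q) i) (typeOf-rep t' realised) (==-≢ q≢rep))
      (∨-trueʳ (∧-trueʳ {is-just t' ∨ othersExist} (∧-trueʳ {not (cutᵗ i t')} ok)) (not-at-rep q t' q≢rep)))

  move-stays-uncut : ∀ i t mv → move-ok i t mv ≡ true → cutᵗ (nextRow i mv) (nextType t mv) ≡ false
  move-stays-uncut i t (vertical j)    ok = not-true (∧-trueˡ ok)
  move-stays-uncut i t (horizontal t') ok = not-true (∧-trueˡ ok)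

  walk-sound : ∀ i q t ms → typeOf d q ≡ t → cutᵗ i t ≡ false → walk-ok i t ms ≡ true →
    Σ (Fin n) λ q' → typeOf d q' ≡ endType i t ms × Reach G S (vtx i q) (vtx (endRow i t ms) q')
                     × cutᵗ (endRow i t ms) (endType i t ms) ≡ false
  walk-sound i q t []        tq uncut ok = q , tq , ε , uncut
  walk-sound i q t (mv ∷ ms) tq uncut ok =
    let q₁ , tq₁ , reach₁ , _ = move-sound i q t mv tq uncut (∧-trueˡ ok)
        q₂ , tq₂ , reach₂ , uncut₂ = walk-sound (nextRow i mv) q₁ (nextType t mv) ms tq₁
                                       (move-stays-uncut i t mv (∧-trueˡ ok)) (∧-trueʳ {move-ok i t mv} ok)
    in q₂ , tq₂ , reach₁ ◅◅ reach₂ , uncut₂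

  root : Fin k → Fin (3 * n)
  root l = vtx (rootRow l) (rep (rootType l))

  typeOf-root : ∀ l → typeOf d (rep (rootType l)) ≡ rootType l
  typeOf-root l = typeOf-rep (rootType l)
    (∧-trueʳ {labelᵗ (rootRow l) (rootType l) == l} (∧-trueʳ {not (cutᵗ (rootRow l) (rootType l))} (roots-ok l)))

  root∉S : ∀ l → root l ∉ S
  root∉S l = vtx∉S (rootRow l) (rep (rootType l))
    (trans (cong (cutᵗ (rootRow l)) (typeOf-root l)) (not-true (∧-trueˡ (roots-ok l))))

  label-root : ∀ l → label (root l) ≡ l
  label-root l = trans (label-vtx (rootRow l) (rep (rootType l)))
    (trans (cong (labelᵗ (rootRow l)) (typeOf-root l))
           (==⇒≡ (∧-trueˡ (∧-trueʳ {not (cutᵗ (rootRow l) (rootType l))} (roots-ok l)))))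

  reach-root-vtx : ∀ i q → cutᵗ i (typeOf d q) ≡ false → Reach G S (vtx i q) (root (labelᵗ i (typeOf d q)))
  reach-root-vtx i q uncut = reach₁ ◅◅ subst₂ (λ i' q' → Reach G S (vtx i₁ q₁) (vtx i' q')) at-root-row (at-rep _ refl) reach₂
    where
    t = typeOf d q
    ms = route i t
    l = labelᵗ i t
    ok = ∨-trueʳ (routes-ok i t) uncut
    walked = walk-sound i q t ms refl uncut (∧-trueˡ ok)
    q₁ = proj₁ walked
    i₁ = endRow i t ms
    reach₁ = proj₁ (proj₂ (proj₂ walked))
    last = ∧-trueʳ {walk-ok i t ms} ok
    moved = move-sound i₁ q₁ (endType i t ms) (horizontal (rootType l)) (proj₁ (proj₂ walked))
                       (proj₂ (proj₂ (proj₂ walked))) (∧-trueˡ last)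
    reach₂ = proj₁ (proj₂ (proj₂ moved))
    at-rep = proj₂ (proj₂ (proj₂ moved))
    at-root-row : i₁ ≡ rootRow l
    at-root-row = ==⇒≡ (∧-trueʳ {move-ok i₁ (endType i t ms) (horizontal (rootType l))} last)

  reach-root : ∀ u → u ∉ S → Reach G S u (root (label u))
  reach-root = ∀-vtx (λ u → u ∉ S → Reach G S u (root (label u))) λ i q q∉S →
    subst (λ l → Reach G S (vtx i q) (root l)) (sym (label-vtx i q)) (reach-root-vtx i q (∉S⇒uncut i q q∉S))

  labelling : Labelling G S k
  labelling = record
    { label = label ; root = root ; root∉S = root∉S ; label-root = label-root
    ; label-step = label-step ; reach-root = reach-root }

  numComponents : NumComponents G S k
  numComponents = labelling⇒numComponents A-symmetric labelling

  ∣S∣≡ : ∣ S ∣ ≡ cutSize W (others d)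
  ∣S∣≡ = trans (∣tabulate∣≡count cut) (count-typed d d-injective cut cutᵗ cut-vtx)

edgeᵗ-KP : ∀ {m} → TypedEdges m
edgeᵗ-KP i t j t' e = (i == j ∧ not e) ∨ (e ∧ adjP3 i j)

atᵗ : ∀ {m} → Fin 3 → Maybe (Fin m) → Fin 3 → Fin m → Bool
atᵗ i t i₀ k = i == i₀ ∧ t ==ᵗ just k

edgeᵗ-H : ∀ {m} → Fin m → TypedEdges m
edgeᵗ-H kₚ i t j t' e = edgeᵗ-KP i t j t' e ∨ ((atᵗ i t 0F kₚ ∧ atᵗ j t' 2F kₚ) ∨ (atᵗ i t 2F kₚ ∧ atᵗ j t' 0F kₚ))

removeᵗ : ∀ {m} → TypedEdges m → Fin 3 → Fin m → Fin 3 → Fin m → TypedEdges m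
removeᵗ E iᵤ kᵤ iᵥ kᵥ i t j t' e = E i t j t' e ∧ not ((atᵗ i t iᵤ kᵤ ∧ atᵗ j t' iᵥ kᵥ) ∨ (atᵗ i t iᵥ kᵥ ∧ atᵗ j t' iᵤ kᵤ))

module Typed {n m} (d : Fin m → Fin n) (d-injective : Injective _≡_ _≡_ d) where

  ==-vtx-d : ∀ i q i₀ k → (vtx i q == vtx {n} i₀ (d k)) ≡ atᵗ i (typeOf d q) i₀ k
  ==-vtx-d i q i₀ k = trans (==-combine i i₀ q (d k)) (cong (i == i₀ ∧_) (==-d≡typeOf d d-injective q k))

  adjKP-typed : ∀ i q j r → adjKP n (vtx i q) (vtx j r) ≡ edgeᵗ-KP i (typeOf d q) j (typeOf d r) (q == r)
  adjKP-typed = adjKP-vtx n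

  adjH-typed : ∀ kₚ i q j r → adjH n (d kₚ) (vtx i q) (vtx j r) ≡ edgeᵗ-H kₚ i (typeOf d q) j (typeOf d r) (q == r)
  adjH-typed kₚ i q j r = cong₂ _∨_ (adjKP-typed i q j r)
    (cong₂ _∨_ (cong₂ _∧_ (==-vtx-d i q 0F kₚ) (==-vtx-d j r 2F kₚ)) (cong₂ _∧_ (==-vtx-d i q 2F kₚ) (==-vtx-d j r 0F kₚ)))

  removeEdge-typed : ∀ (A : Fin (3 * n) → Fin (3 * n) → Bool) E →
    (∀ i q j r → A (vtx i q) (vtx j r) ≡ E i (typeOf d q) j (typeOf d r) (q == r)) →
    ∀ iᵤ kᵤ iᵥ kᵥ i q j r → adj (removeEdge (graph (3 * n) A) (vtx iᵤ (d kᵤ)) (vtx iᵥ (d kᵥ))) (vtx i q) (vtx j r)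
      ≡ removeᵗ E iᵤ kᵤ iᵥ kᵥ i (typeOf d q) j (typeOf d r) (q == r)
  removeEdge-typed A E A-typed iᵤ kᵤ iᵥ kᵥ i q j r = cong₂ _∧_ (A-typed i q j r) (cong not (cong₂ _∨_
    (cong₂ _∧_ (==-vtx-d i q iᵤ kᵤ) (==-vtx-d j r iᵥ kᵥ)) (cong₂ _∧_ (==-vtx-d i q iᵥ kᵥ) (==-vtx-d j r iᵤ kᵤ))))

  removeEdge-KP-typed : ∀ iᵤ kᵤ iᵥ kᵥ i q j r →
    adj (removeEdge (KnP3 n) (vtx iᵤ (d kᵤ)) (vtx iᵥ (d kᵥ))) (vtx i q) (vtx j r)
      ≡ removeᵗ edgeᵗ-KP iᵤ kᵤ iᵥ kᵥ i (typeOf d q) j (typeOf d r) (q == r)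
  removeEdge-KP-typed = removeEdge-typed (adjKP n) edgeᵗ-KP adjKP-typed

  removeEdge-H-typed : ∀ kₚ iᵤ kᵤ iᵥ kᵥ i q j r →
    adj (removeEdge (graph (3 * n) (adjH n (d kₚ))) (vtx iᵤ (d kᵤ)) (vtx iᵥ (d kᵥ))) (vtx i q) (vtx j r)
      ≡ removeᵗ (edgeᵗ-H kₚ) iᵤ kᵤ iᵥ kᵥ i (typeOf d q) j (typeOf d r) (q == r)
  removeEdge-H-typed kₚ = removeEdge-typed (adjH n (d kₚ)) (edgeᵗ-H kₚ) (adjH-typed kₚ)

module Refute {m k} (W : Certificate m k) (W-valid : Check.valid W ≡ true) where
  open Certificate W

  module _ {n} (R : Realisation W n) where
    open Realisation R
    open Soundness W W-valid R

    ¬tough : 2 ≤ k → (∀ c → n ≡ c + m → 3 * cutSize W c < k * suc n) → ¬ Tough G (τ n)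
    ¬tough 2≤k small = components-¬tough 2≤k numComponents
      (subst (λ s → 3 * s < k * suc n) (sym ∣S∣≡) (small (others d) (n≡others+m d d-injective)))

    ¬tougher : k ≡ 3 → (∀ c → n ≡ c + m → cutSize W c ≤ suc n) → ∀ t' → τ n <ℚ t' → ¬ Tough G t'
    ¬tougher refl small = components-¬tougher numComponents
      (subst (_≤ suc n) (sym ∣S∣≡) (small (others d) (n≡others+m d d-injective)))

  module Deleted {n} (R : Realisation W (suc n)) (kₚ : Fin m) (cut-wₚ : cutᵗ 1F (just kₚ) ≡ true) where
    open Realisation R
    open Soundness W W-valid R

    w : Fin (3 * suc n)
    w = vtx 1F (d kₚ)

    w∈S : lookup S w ≡ true
    w∈S = trans (lookup∘tabulate cut w) (trans (cut-vtx 1F (d kₚ)) (trans (cong (cutᵗ 1F) (typeOf-d d d-injective kₚ)) cut-wₚ))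

    S₀ : Subset (pred (3 * suc n))
    S₀ = tabulate (lookup S ∘ punchIn w)

    open DeletedVertex A w S S₀ w∈S (lookup∘tabulate (lookup S ∘ punchIn w))

    1+∣S₀∣≡cutSize : suc ∣ S₀ ∣ ≡ cutSize W (others d)
    1+∣S₀∣≡cutSize = trans (sym ∣S∣≡1+∣S₀∣) ∣S∣≡

    ¬tough-deleted : 2 ≤ k → (∀ c → suc n ≡ c + m → 3 * cutSize W c < 3 + k * suc (suc n)) →
      ¬ Tough (deleteVertex A w) (τ (suc n))
    ¬tough-deleted 2≤k small = components-¬tough 2≤k (numComponents-drop numComponents) (ℕ.+-cancelˡ-< 3 _ _
      (subst (_< 3 + k * suc (suc n)) (trans (cong (3 *_) (sym 1+∣S₀∣≡cutSize)) (ℕ.*-suc 3 ∣ S₀ ∣))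
        (small (others d) (n≡others+m d d-injective))))

    ¬tougher-deleted : k ≡ 3 → (∀ c → suc n ≡ c + m → cutSize W c ≤ suc (suc (suc n))) →
      ∀ t' → τ (suc n) <ℚ t' → ¬ Tough (deleteVertex A w) t'
    ¬tougher-deleted refl small = components-¬tougher (numComponents-drop numComponents)
      (ℕ.≤-pred (subst (_≤ suc (suc (suc n))) (sym 1+∣S₀∣≡cutSize) (small (others d) (n≡others+m d d-injective))))

degree-typed : ∀ {n m} (d : Fin m → Fin n) (d-inj : Injective _≡_ _≡_ d)
  (A : Fin (3 * n) → Fin (3 * n) → Bool) (E : TypedEdges m) →
  (∀ i (q : Fin n) j r → A (vtx i q) (vtx j r) ≡ E i (typeOf d q) j (typeOf d r) (q == r)) → ∀ i k₀ →
  count (A (vtx i (d k₀))) ≡ sum (λ j → bit (E i (just k₀) j nothing false)) * others d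
                            + sum (λ j → sum (λ k → bit (E i (just k₀) j (just k) (k == k₀))))
degree-typed d d-inj A E A-type i k₀ =
  count-typed d d-inj (A (vtx i (d k₀))) (λ j t → E i (just k₀) j t (t ==ᵗ just k₀)) λ j r →
  trans (A-type i (d k₀) j r) (cong₂ (λ t e → E i t j (typeOf d r) e) (typeOf-d d d-inj k₀)
    (trans (==-sym (d k₀) r) (==-d≡typeOf d d-inj r k₀)))

mirror : Fin 3 → Fin 3
mirror 0F = 2F
mirror 1F = 1F
mirror 2F = 0F

-- Each comment below names the distinguished columns in the order of their types just 0F,
-- just 1F, just 2F (nothing stands for every other column) and gives S in (row, column)
-- coordinates, together with the resulting components of G ∖ S.

-- K_n □ P_3; a. S = row 1 ∖ {a} ∪ {(0,a), (2,a)}: row 0 ∖ {a}, {(1,a)}, row 2 ∖ {a}.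
tight-KP : Certificate 1 3
tight-KP = record
  { edgeᵗ = edgeᵗ-KP ; cutᵗ = cut ; labelᵗ = λ i _ → i ; rootRow = λ l → l ; rootType = root
  ; route = λ _ _ → [] ; othersExist = true }
  where
  cut : Fin 3 → Maybe (Fin 1) → Bool
  cut i t = if i == 1F then is-nothing t else is-just t
  root : Fin 3 → Maybe (Fin 1)
  root l = if l == 1F then just 0F else nothing

-- K_n □ P_3 − (i,a)(i,b), i outer; a, b. S = row i ∖ {a,b} ∪ {(1,a), (1,b)}: {(i,a)}, {(i,b)}, the rest.
outer-row-edge-KP : Fin 3 → Certificate 2 3
outer-row-edge-KP i = record
  { edgeᵗ = removeᵗ edgeᵗ-KP i 0F i 1F ; cutᵗ = cut ; labelᵗ = label ; rootRow = λ l → if l == 2F then mirror i else i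
  ; rootType = λ l → if l == 1F then just 1F else just 0F
  ; route = λ i' _ → if i' == 1F then vertical (mirror i) ∷ [] else [] ; othersExist = false }
  where
  cut : Fin 3 → Maybe (Fin 2) → Bool
  cut i' t = if i' == i then is-nothing t else (if i' == 1F then is-just t else false)
  label : Fin 3 → Maybe (Fin 2) → Fin 3
  label i' t = if i' == i then (if t ==ᵗ just 0F then 0F else (if t ==ᵗ just 1F then 1F else 2F)) else 2F

-- K_n □ P_3 − (1,a)(1,b); a, b. S = row 1 ∖ {a,b} ∪ {(0,a), (0,b), (2,a), (2,b)}:
-- {(1,a)}, {(1,b)}, row 0 ∖ {a,b}, row 2 ∖ {a,b}.
middle-row-edge-KP : Certificate 2 4
middle-row-edge-KP = record
  { edgeᵗ = removeᵗ edgeᵗ-KP 1F 0F 1F 1F ; cutᵗ = cut ; labelᵗ = label ; rootRow = row' ; rootType = root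
  ; route = λ _ _ → [] ; othersExist = true }
  where
  cut : Fin 3 → Maybe (Fin 2) → Bool
  cut i t = if i == 1F then is-nothing t else is-just t
  label : Fin 3 → Maybe (Fin 2) → Fin 4
  label i t = if i == 1F then (if t ==ᵗ just 1F then 1F else 0F) else (if i == 0F then 2F else 3F)
  row' : Fin 4 → Fin 3
  row' l = if l == 2F then 0F else (if l == 3F then 2F else 1F)
  root : Fin 4 → Maybe (Fin 2)
  root l = if l == 0F then just 0F else (if l == 1F then just 1F else nothing)

-- K_n □ P_3 − (i,a)(1,a), i outer; a. S = row 1 ∖ {a} ∪ {(mirror i, a)}: row i, {(1,a)}, row (mirror i) ∖ {a}.
column-edge-KP : Fin 3 → Certificate 1 3
column-edge-KP i = record
  { edgeᵗ = removeᵗ edgeᵗ-KP i 0F 1F 0F ; cutᵗ = cut ; labelᵗ = label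
  ; rootRow = λ l → if l == 0F then i else (if l == 1F then 1F else mirror i)
  ; rootType = λ l → if l == 2F then nothing else just 0F ; route = λ _ _ → [] ; othersExist = true }
  where
  cut : Fin 3 → Maybe (Fin 1) → Bool
  cut i' t = if i' == 1F then is-nothing t else (if i' == i then false else is-just t)
  label : Fin 3 → Maybe (Fin 1) → Fin 3
  label i' t = if i' == 1F then 1F else (if i' == i then 0F else 2F)

-- H; a ≠ p, p. S = row 1 ∖ {a} ∪ {(0,a), (0,p), (2,a)}: row 0 ∖ {a,p}, {(1,a)}, row 2 ∖ {a}.
tight-H : Certificate 2 3
tight-H = record
  { edgeᵗ = edgeᵗ-H 1F ; cutᵗ = cut ; labelᵗ = λ i _ → i ; rootRow = λ l → l ; rootType = root
  ; route = λ _ _ → [] ; othersExist = true }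
  where
  cut : Fin 3 → Maybe (Fin 2) → Bool
  cut i t = if i == 1F then not (t ==ᵗ just 0F) else (if i == 0F then is-just t else t ==ᵗ just 0F)
  root : Fin 3 → Maybe (Fin 2)
  root l = if l == 0F then nothing else (if l == 1F then just 0F else just 1F)

-- H − (i,a)(i,b), i outer; a, b, p. S = row i ∖ {a,b} ∪ {(1,a), (1,b), (1,p)}: {(i,a)}, {(i,b)}, the rest.
outer-row-edge-H : Fin 3 → Certificate 3 3
outer-row-edge-H i = record
  { edgeᵗ = removeᵗ (edgeᵗ-H 2F) i 0F i 1F ; cutᵗ = cut ; labelᵗ = label ; rootRow = λ l → if l == 2F then mirror i else i
  ; rootType = λ l → if l == 1F then just 1F else just 0F
  ; route = λ i' _ → if i' == 1F then vertical (mirror i) ∷ [] else [] ; othersExist = false }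
  where
  cut : Fin 3 → Maybe (Fin 3) → Bool
  cut i' t = if i' == i then (is-nothing t ∨ t ==ᵗ just 2F) else (if i' == 1F then is-just t else false)
  label : Fin 3 → Maybe (Fin 3) → Fin 3
  label i' t = if i' == i then (if t ==ᵗ just 0F then 0F else (if t ==ᵗ just 1F then 1F else 2F)) else 2F

-- H − (i,p)(i,b), i outer; p, b. S = row i ∖ {p,b} ∪ {(1,p), (1,b), (mirror i, p)}: {(i,p)}, {(i,b)}, the rest.
outer-row-edge-at-p-H : Fin 3 → Certificate 2 3
outer-row-edge-at-p-H i = record
  { edgeᵗ = removeᵗ (edgeᵗ-H 0F) i 0F i 1F ; cutᵗ = cut ; labelᵗ = label ; rootRow = λ l → if l == 2F then mirror i else i
  ; rootType = λ l → if l == 0F then just 0F else just 1F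
  ; route = λ i' _ → if i' == 1F then vertical (mirror i) ∷ [] else [] ; othersExist = false }
  where
  cut : Fin 3 → Maybe (Fin 2) → Bool
  cut i' t = if i' == i then is-nothing t else (if i' == 1F then is-just t else t ==ᵗ just 0F)
  label : Fin 3 → Maybe (Fin 2) → Fin 3
  label i' t = if i' == i then (if t ==ᵗ just 0F then 0F else (if t ==ᵗ just 1F then 1F else 2F)) else 2F

-- H − (1,a)(1,b); a, b, p. S = row 1 ∖ {a,b} ∪ {(0,a), (0,b), (0,p), (2,a), (2,b)}:
-- {(1,a)}, {(1,b)}, row 0 ∖ {a,b,p}, row 2 ∖ {a,b}. The root of row 0 needs a fourth column, so n ≥ 4.
middle-row-edge-H : Certificate 3 4
middle-row-edge-H = record
  { edgeᵗ = removeᵗ (edgeᵗ-H 2F) 1F 0F 1F 1F ; cutᵗ = cut ; labelᵗ = label ; rootRow = row' ; rootType = root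
  ; route = λ _ _ → [] ; othersExist = true }
  where
  cut : Fin 3 → Maybe (Fin 3) → Bool
  cut i t = if i == 1F then (is-nothing t ∨ t ==ᵗ just 2F)
            else (if i == 0F then is-just t else (t ==ᵗ just 0F ∨ t ==ᵗ just 1F))
  label : Fin 3 → Maybe (Fin 3) → Fin 4
  label i t = if i == 1F then (if t ==ᵗ just 1F then 1F else 0F) else (if i == 0F then 2F else 3F)
  row' : Fin 4 → Fin 3
  row' l = if l == 2F then 0F else (if l == 3F then 2F else 1F)
  root : Fin 4 → Maybe (Fin 3)
  root l = if l == 0F then just 0F else (if l == 1F then just 1F else (if l == 2F then nothing else just 2F))

-- The same for n = 3; a, b, p. S = {(1,p), (0,a), (2,a)}: {(1,a)}, the rest.
middle-row-edge-H₃ : Certificate 3 2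
middle-row-edge-H₃ = record
  { edgeᵗ = removeᵗ (edgeᵗ-H 2F) 1F 0F 1F 1F ; cutᵗ = cut ; labelᵗ = label
  ; rootRow = λ l → if l == 0F then 1F else 0F ; rootType = λ l → if l == 0F then just 0F else just 1F
  ; route = route' ; othersExist = false }
  where
  cut : Fin 3 → Maybe (Fin 3) → Bool
  cut i t = is-nothing t ∨ (if i == 1F then t ==ᵗ just 2F else t ==ᵗ just 0F)
  label : Fin 3 → Maybe (Fin 3) → Fin 2
  label i t = if i == 1F then (if t ==ᵗ just 0F then 0F else 1F) else 1F
  route' : Fin 3 → Maybe (Fin 3) → List (Move 3)
  route' i t = if i == 1F then (if t ==ᵗ just 0F then [] else vertical 0F ∷ [])
               else (if i == 2F then (if t ==ᵗ just 2F then vertical 0F ∷ [] else vertical 1F ∷ vertical 0F ∷ []) else [])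

-- H − (i,a)(1,a), i outer; a ≠ p, p. S = row 1 ∖ {a} ∪ {(i,p), (mirror i, a)}: row i ∖ {p}, {(1,a)}, row (mirror i) ∖ {a}.
column-edge-H : Fin 3 → Certificate 2 3
column-edge-H i = record
  { edgeᵗ = removeᵗ (edgeᵗ-H 1F) i 0F 1F 0F ; cutᵗ = cut ; labelᵗ = label
  ; rootRow = λ l → if l == 0F then i else (if l == 1F then 1F else mirror i)
  ; rootType = λ l → if l == 2F then just 1F else just 0F ; route = λ _ _ → [] ; othersExist = false }
  where
  cut : Fin 3 → Maybe (Fin 2) → Bool
  cut i' t = if i' == 1F then not (t ==ᵗ just 0F) else (if i' == i then t ==ᵗ just 1F else t ==ᵗ just 0F)
  label : Fin 3 → Maybe (Fin 2) → Fin 3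
  label i' t = if i' == 1F then 1F else (if i' == i then 0F else 2F)

-- H − (0,p)(2,p); a ≠ p, p. S = row 1 ∖ {a} ∪ {(0,a), (2,a)}: row 0 ∖ {a}, {(1,a)}, row 2 ∖ {a}.
shortcut-edge-H : Certificate 2 3
shortcut-edge-H = record
  { edgeᵗ = removeᵗ (edgeᵗ-H 1F) 0F 1F 2F 1F ; cutᵗ = cut ; labelᵗ = λ i _ → i ; rootRow = λ l → l
  ; rootType = λ l → if l == 1F then just 0F else just 1F ; route = λ _ _ → [] ; othersExist = false }
  where
  cut : Fin 3 → Maybe (Fin 2) → Bool
  cut i t = if i == 1F then not (t ==ᵗ just 0F) else t ==ᵗ just 0F

<-by-gap : ∀ {a b} g → suc (a + g) ≡ b → a < b
<-by-gap {a} g eq = subst (a <_) eq (s≤s (ℕ.m≤m+n a g))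

small-cut : ∀ {n} M c → n ≡ c + M → 3 * (1 * c + M) < 3 * suc n
small-cut M c refl = <-by-gap 2 (eq M c)
  where
  eq : ∀ M c → suc (3 * (1 * c + M) + 2) ≡ 3 * suc (c + M)
  eq = solve-∀

small-cut+w : ∀ {n} M c → n ≡ c + M → 3 * (1 * c + suc M) < 3 + 3 * suc n
small-cut+w M c refl = <-by-gap 2 (eq M c)
  where
  eq : ∀ M c → suc (3 * (1 * c + suc M) + 2) ≡ 3 + 3 * suc (c + M)
  eq = solve-∀

rowDegree : ℕ → Fin 3 → ℕ
rowDegree n 0F = n
rowDegree n 1F = suc n
rowDegree n 2F = n

degree-KP : ∀ n i (q : Fin n) → deg (KnP3 n) (vtx i q) ≡ rowDegree n i
degree-KP n i q = trans (∣tabulate∣≡count (adjKP n (vtx i q)))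
  (trans (degree-typed (cols₁ q) (cols₁-injective q) (adjKP n) edgeᵗ-KP (Typed.adjKP-typed (cols₁ q) (cols₁-injective q)) i 0F)
         (by-row i))
  where
  c = others (cols₁ q)
  n≡c+1 : n ≡ c + 1
  n≡c+1 = n≡others+m (cols₁ q) (cols₁-injective q)
  outer : 1 * c + 1 ≡ n
  outer = trans (cong (_+ 1) (ℕ.*-identityˡ c)) (sym n≡c+1)
  by-row : ∀ i → sum (λ j → bit (edgeᵗ-KP {1} i (just 0F) j nothing false)) * c
                 + sum (λ j → sum (λ k → bit (edgeᵗ-KP {1} i (just 0F) j (just k) (k == 0F)))) ≡ rowDegree n i
  by-row 0F = outer
  by-row 1F = trans (cong (_+ 2) (ℕ.*-identityˡ c)) (trans (ℕ.+-suc c 1) (cong suc (sym n≡c+1)))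
  by-row 2F = outer

rowDegree-≥ : ∀ n i → n ≤ rowDegree n i
rowDegree-≥ n 0F = ℕ.≤-refl
rowDegree-≥ n 1F = ℕ.n≤1+n n
rowDegree-≥ n 2F = ℕ.≤-refl

rowDegree-≤ : ∀ n i → rowDegree n i ≤ suc n
rowDegree-≤ n 0F = ℕ.n≤1+n n
rowDegree-≤ n 1F = ℕ.≤-refl
rowDegree-≤ n 2F = ℕ.n≤1+n n

module _ (n : ℕ) (q : Fin n) where
  minDegree-KP : MinDegreeIs (KnP3 n) n
  minDegree-KP = ∀-vtx (λ v → n ≤ deg (KnP3 n) v) (λ i q → subst (n ≤_) (sym (degree-KP n i q)) (rowDegree-≥ n i))
               , vtx 0F q , degree-KP n 0F q

  maxDegree-KP : MaxDegreeIs (KnP3 n) (suc n)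
  maxDegree-KP = ∀-vtx (λ v → deg (KnP3 n) v ≤ suc n) (λ i q → subst (_≤ suc n) (sym (degree-KP n i q)) (rowDegree-≤ n i))
               , vtx 1F q , degree-KP n 1F q

  ¬regular-KP : ¬ (∃ λ r → Regular (KnP3 n) r)
  ¬regular-KP (r , regular) = ℕ.1+n≢n (begin
    suc n                   ≡⟨ degree-KP n 1F q ⟨
    deg (KnP3 n) (vtx 1F q) ≡⟨ trans (regular _) (sym (regular _)) ⟩
    deg (KnP3 n) (vtx 0F q) ≡⟨ degree-KP n 0F q ⟩
    n                       ∎)
    where open ≡-Reasoning

module KnP3-toughness (n : ℕ) (n≥3 : 3 ≤ n) where
  K : Graph
  K = KnP3 n

  n≥2 : 2 ≤ n
  n≥2 = ℕ.≤-trans (s≤s (s≤s z≤n)) n≥3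

  some-column : Fin n
  some-column = fromℕ< (ℕ.≤-trans (s≤s z≤n) n≥3)

  ¬tougher-K : ∀ t' → τ n <ℚ t' → ¬ Tough K t'
  ¬tougher-K = Refute.¬tougher tight-KP refl R refl small
    where
    a = some-column
    o = fresh n≥2 (cols₁ a)
    R : Realisation tight-KP n
    R = record { d = cols₁ a ; d-injective = cols₁-injective a ; other = proj₁ o
               ; other-type = λ _ → typeOf-nothing (cols₁ a) (proj₁ o) (proj₂ o)
               ; A = adjKP n ; A-type = Typed.adjKP-typed (cols₁ a) (cols₁-injective a) }
    small : ∀ c → n ≡ c + 1 → 1 * c + 2 ≤ suc n
    small c refl = ℕ.≤-reflexive (eq c)
      where
      eq : ∀ c → 1 * c + 2 ≡ suc (c + 1)
      eq = solve-∀

  -- The certificate depends on the row i, so it is checked for i = 0F and i = 2F separately.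
  outer-row-edge : ∀ i → Check.valid (outer-row-edge-KP i) ≡ true →
    (∀ c → n ≡ c + 2 → 3 * cutSize (outer-row-edge-KP i) c < 3 * suc n) →
    ∀ {a b : Fin n} → a ≢ b → ¬ Tough (removeEdge K (vtx i a) (vtx i b)) (τ n)
  outer-row-edge i W-valid small {a} {b} a≢b = Refute.¬tough (outer-row-edge-KP i) W-valid R (s≤s (s≤s z≤n)) small
    where
    R : Realisation (outer-row-edge-KP i) n
    R = record { d = cols₂ a b ; d-injective = cols₂-injective a≢b ; other = a ; other-type = λ ()
               ; A = adj (removeEdge K (vtx i a) (vtx i b))
               ; A-type = Typed.removeEdge-KP-typed (cols₂ a b) (cols₂-injective a≢b) i 0F i 1F }

  ¬tough-outer-row-edge : ∀ i → i ≢ 1F → ∀ {a b : Fin n} → a ≢ b → ¬ Tough (removeEdge K (vtx i a) (vtx i b)) (τ n)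
  ¬tough-outer-row-edge 0F _   = outer-row-edge 0F refl (small-cut 2)
  ¬tough-outer-row-edge 1F 1≢1 = ⊥-elim (1≢1 refl)
  ¬tough-outer-row-edge 2F _   = outer-row-edge 2F refl (small-cut 2)

  ¬tough-middle-row-edge : ∀ {a b : Fin n} → a ≢ b → ¬ Tough (removeEdge K (vtx 1F a) (vtx 1F b)) (τ n)
  ¬tough-middle-row-edge {a} {b} a≢b = Refute.¬tough middle-row-edge-KP refl R (s≤s (s≤s z≤n)) small₄
    where
    o = fresh n≥3 (cols₂ a b)
    R : Realisation middle-row-edge-KP n
    R = record { d = cols₂ a b ; d-injective = cols₂-injective a≢b ; other = proj₁ o
               ; other-type = λ _ → typeOf-nothing (cols₂ a b) (proj₁ o) (proj₂ o)
               ; A = adj (removeEdge K (vtx 1F a) (vtx 1F b))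
               ; A-type = Typed.removeEdge-KP-typed (cols₂ a b) (cols₂-injective a≢b) 1F 0F 1F 1F }
    small₄ : ∀ c → n ≡ c + 2 → 3 * (1 * c + 4) < 4 * suc n
    small₄ zero    refl = ⊥-elim (3≰2 n≥3)
      where
      3≰2 : ¬ 3 ≤ 2
      3≰2 (s≤s (s≤s ()))
    small₄ (suc c) refl = <-by-gap c (eq c)
      where
      eq : ∀ c → suc (3 * (1 * suc c + 4) + c) ≡ 4 * suc (suc c + 2)
      eq = solve-∀

  column-edge : ∀ i → Check.valid (column-edge-KP i) ≡ true →
    (∀ c → n ≡ c + 1 → 3 * cutSize (column-edge-KP i) c < 3 * suc n) →
    ∀ (a : Fin n) → ¬ Tough (removeEdge K (vtx i a) (vtx 1F a)) (τ n)
  column-edge i W-valid small a = Refute.¬tough (column-edge-KP i) W-valid R (s≤s (s≤s z≤n)) small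
    where
    o = fresh n≥2 (cols₁ a)
    R : Realisation (column-edge-KP i) n
    R = record { d = cols₁ a ; d-injective = cols₁-injective a ; other = proj₁ o
               ; other-type = λ _ → typeOf-nothing (cols₁ a) (proj₁ o) (proj₂ o)
               ; A = adj (removeEdge K (vtx i a) (vtx 1F a))
               ; A-type = Typed.removeEdge-KP-typed (cols₁ a) (cols₁-injective a) i 0F 1F 0F }

  ¬tough-column-edge : ∀ i → i ≢ 1F → ∀ (a : Fin n) → ¬ Tough (removeEdge K (vtx i a) (vtx 1F a)) (τ n)
  ¬tough-column-edge 0F _   = column-edge 0F refl (small-cut 1)
  ¬tough-column-edge 1F 1≢1 = ⊥-elim (1≢1 refl)
  ¬tough-column-edge 2F _   = column-edge 2F refl (small-cut 1)

  ¬tough-removeEdge : ∀ u v → adj K u v ≡ true → ¬ Tough (removeEdge K u v) (τ n)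
  ¬tough-removeEdge = ∀-vtx² (λ u v → adj K u v ≡ true → ¬ Tough (removeEdge K u v) (τ n)) λ i q j r uv →
    by-cases i q j r (adjKP-edge n i q j r uv)
    where
    by-cases : ∀ i (q : Fin n) j r → (i ≡ j × q ≢ r) ⊎ (q ≡ r × adjP3 i j ≡ true) →
      ¬ Tough (removeEdge K (vtx i q) (vtx j r)) (τ n)
    by-cases i q .i r (inj₁ (refl , q≢r)) with i ≟ 1F
    ... | yes refl = ¬tough-middle-row-edge q≢r
    ... | no i≢1   = ¬tough-outer-row-edge i i≢1 q≢r
    by-cases i q j .q (inj₂ (refl , ij)) with adjP3-edge i j ij
    ... | inj₁ (i≢1 , refl) = ¬tough-column-edge i i≢1 q
    ... | inj₂ (refl , j≢1) = ¬tough-cong (removeEdge-comm K (vtx j q) (vtx 1F q)) (¬tough-column-edge j j≢1 q)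

  tough-K : Tough K (τ n)
  tough-K = tough-criterion K n≥2 (λ S → lower₂ S) (λ S → lower₃ S) (λ S → ¬scattered₄ S)
    where open GridBounds (adjKP n) (adjKP-row n) (adjKP-col n) (adjKP-symmetric n)

degree-H : ∀ n p i (q : Fin n) → vtx i q ≢ vtx 1F p →
  count (adjH n p (vtx i q)) ≡ bit (adjH n p (vtx i q) (vtx 1F p)) + n
degree-H n p i q iq≢w with q ≟ p
... | no q≢p = begin
  count (adjH n p (vtx i q))
    ≡⟨ degree-typed d d-inj (adjH n p) (edgeᵗ-H 1F) (Typed.adjH-typed d d-inj 1F) i 0F ⟩
  sum (λ j → bit (edgeᵗ-H {2} 1F i (just 0F) j nothing false)) * c
    + sum (λ j → sum (λ k → bit (edgeᵗ-H {2} 1F i (just 0F) j (just k) (k == 0F))))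
    ≡⟨ by-row i ⟩
  bit (edgeᵗ-H {2} 1F i (just 0F) 1F (just 1F) false) + n
    ≡⟨ cong (λ e → bit e + n) (sym to-w) ⟩
  bit (adjH n p (vtx i q) (vtx 1F p)) + n ∎
  where
  open ≡-Reasoning
  d = cols₂ q p
  d-inj = cols₂-injective q≢p
  c = others d
  n≡c+2 : n ≡ c + 2
  n≡c+2 = n≡others+m d d-inj
  to-w : adjH n p (vtx i q) (vtx 1F p) ≡ edgeᵗ-H {2} 1F i (just 0F) 1F (just 1F) false
  to-w = trans (Typed.adjH-typed d d-inj 1F i q 1F p)
    (trans (cong (λ t → edgeᵗ-H 1F i t 1F (typeOf d p) (q == p)) (typeOf-d d d-inj 0F))
           (cong₂ (edgeᵗ-H 1F i (just 0F) 1F) (typeOf-d d d-inj 1F) (==-≢ q≢p)))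
  outer : 1 * c + 2 ≡ n
  outer = trans (cong (_+ 2) (ℕ.*-identityˡ c)) (sym n≡c+2)
  by-row : ∀ i → sum (λ j → bit (edgeᵗ-H {2} 1F i (just 0F) j nothing false)) * c
                 + sum (λ j → sum (λ k → bit (edgeᵗ-H {2} 1F i (just 0F) j (just k) (k == 0F))))
                 ≡ bit (edgeᵗ-H {2} 1F i (just 0F) 1F (just 1F) false) + n
  by-row 0F = outer
  by-row 1F = trans (cong (_+ 3) (ℕ.*-identityˡ c)) (trans (ℕ.+-suc c 2) (cong suc (sym n≡c+2)))
  by-row 2F = outer
... | yes refl = begin
  count (adjH n p (vtx i p))
    ≡⟨ degree-typed d d-inj (adjH n p) (edgeᵗ-H 0F) (Typed.adjH-typed d d-inj 0F) i 0F ⟩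
  sum (λ j → bit (edgeᵗ-H {1} 0F i (just 0F) j nothing false)) * c
    + sum (λ j → sum (λ k → bit (edgeᵗ-H {1} 0F i (just 0F) j (just k) (k == 0F))))
    ≡⟨ by-row i iq≢w ⟩
  bit (edgeᵗ-H {1} 0F i (just 0F) 1F (just 0F) true) + n
    ≡⟨ cong (λ e → bit e + n) (sym to-w) ⟩
  bit (adjH n p (vtx i p) (vtx 1F p)) + n ∎
  where
  open ≡-Reasoning
  d = cols₁ p
  d-inj = cols₁-injective p
  c = others d
  n≡c+1 : n ≡ c + 1
  n≡c+1 = n≡others+m d d-inj
  to-w : adjH n p (vtx i p) (vtx 1F p) ≡ edgeᵗ-H {1} 0F i (just 0F) 1F (just 0F) true
  to-w = trans (Typed.adjH-typed d d-inj 0F i p 1F p)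
    (cong₂ (λ t e → edgeᵗ-H 0F i t 1F t e) (typeOf-d d d-inj 0F) (==-refl p))
  outer : 1 * c + 2 ≡ 1 + n
  outer = trans (cong (_+ 2) (ℕ.*-identityˡ c)) (trans (ℕ.+-suc c 1) (cong suc (sym n≡c+1)))
  by-row : ∀ i → vtx i p ≢ vtx 1F p → sum (λ j → bit (edgeᵗ-H {1} 0F i (just 0F) j nothing false)) * c
                 + sum (λ j → sum (λ k → bit (edgeᵗ-H {1} 0F i (just 0F) j (just k) (k == 0F))))
                 ≡ bit (edgeᵗ-H {1} 0F i (just 0F) 1F (just 0F) true) + n
  by-row 0F _   = outer
  by-row 1F w≢w = ⊥-elim (w≢w refl)
  by-row 2F _   = outer

regular-G₀ : ∀ n (p : Fin (suc n)) → Regular (G₀ (suc n) p) (suc n)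
regular-G₀ n p x = ℕ.+-cancelˡ-≡ (bit (A u w)) _ _ (begin
  bit (A u w) + deg (G₀ (suc n) p) x      ≡⟨ cong (_+_ (bit (A u w))) (∣tabulate∣≡count (A u ∘ punchIn w)) ⟩
  bit (A u w) + count (A u ∘ punchIn w)   ≡⟨ count-remove w (A u) ⟨
  count (A u)                             ≡⟨ ∀-vtx (λ u → u ≢ w → count (A u) ≡ bit (A u w) + suc n) (degree-H (suc n) p) u
                                                   (punchInᵢ≢i w x) ⟩
  bit (A u w) + suc n                     ∎)
  where
  open ≡-Reasoning
  A = adjH (suc n) p
  w = vtx 1F p
  u = punchIn w x

module G₀-toughness (n' : ℕ) (n≥3 : 3 ≤ suc n') (p : Fin (suc n')) where
  n : ℕ
  n = suc n'

  n≥2 : 2 ≤ n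
  n≥2 = ℕ.≤-trans (s≤s (s≤s z≤n)) n≥3

  H : Graph
  H = graph (3 * n) (adjH n p)

  w : Fin (3 * n)
  w = vtx 1F p

  Refuted : Fin (3 * n) → Fin (3 * n) → Set
  Refuted u v = ¬ Tough (deleteVertex (adj (removeEdge H u v)) w) (τ n)

  refuted-comm : ∀ u v → Refuted u v → Refuted v u
  refuted-comm u v = ¬tough-cong (λ a b → removeEdge-comm H u v (punchIn w a) (punchIn w b))

  tough-G₀ : Tough (G₀ n p) (τ n)
  tough-G₀ = tough-criterion (G₀ n p) n≥2
    (λ S₀ sc → ℕ.≤-pred (subst (suc n ≤_) (∣S∣≡1+∣S₀∣ S₀) (Sh.lower₂ₛ S₀ (scattered-lift S₀ sc))))
    (λ S₀ sc → ℕ.≤-pred (subst (suc (suc n) ≤_) (∣S∣≡1+∣S₀∣ S₀) (Sh.lower₃ₛ S₀ (scattered-lift S₀ sc))))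
    (λ S₀ sc → ¬scattered₄ (S S₀) (scattered-lift S₀ sc))
    where
    open GridBounds (adjH n p) (adjH-row n p) (adjH-col n p) (adjH-symmetric n p)
    S : Subset (pred (3 * n)) → Subset (3 * n)
    S S₀ = insertAt S₀ w true
    w∈S : ∀ S₀ → lookup (S S₀) w ≡ true
    w∈S S₀ = insertAt-lookup S₀ w true
    module Sh S₀ = Shortcut (S S₀) p (adjH-shortcut n p) (w∈S S₀)
    open module D S₀ = DeletedVertex (adjH n p) w (S S₀) S₀ (w∈S S₀) (λ x → sym (insertAt-punchIn S₀ w true x))

  ¬tougher-G₀ : ∀ t' → τ n <ℚ t' → ¬ Tough (G₀ n p) t'
  ¬tougher-G₀ = Refute.Deleted.¬tougher-deleted tight-H refl R 1F refl refl small
    where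
    s = fresh n≥2 (cols₁ p)
    s≢p = proj₂ s 0F
    d = cols₂ (proj₁ s) p
    o = fresh n≥3 d
    R : Realisation tight-H n
    R = record { d = d ; d-injective = cols₂-injective s≢p ; other = proj₁ o
               ; other-type = λ _ → typeOf-nothing d (proj₁ o) (proj₂ o)
               ; A = adjH n p ; A-type = Typed.adjH-typed d (cols₂-injective s≢p) 1F }
    small : ∀ c → n ≡ c + 2 → 1 * c + 4 ≤ suc (suc n)
    small c n≡c+2 = ℕ.≤-reflexive (trans (eq c) (cong (suc ∘ suc) (sym n≡c+2)))
      where
      eq : ∀ c → 1 * c + 4 ≡ suc (suc (c + 2))
      eq = solve-∀

  outer-row-edge : ∀ i → Check.valid (outer-row-edge-H i) ≡ true →
    Certificate.cutᵗ (outer-row-edge-H i) 1F (just 2F) ≡ true →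
    (∀ c → n ≡ c + 3 → 3 * cutSize (outer-row-edge-H i) c < 3 + 3 * suc n) →
    ∀ {a b} → a ≢ b → a ≢ p → b ≢ p → Refuted (vtx i a) (vtx i b)
  outer-row-edge i W-valid cut-w small {a} {b} a≢b a≢p b≢p =
    Refute.Deleted.¬tough-deleted (outer-row-edge-H i) W-valid R 2F cut-w (s≤s (s≤s z≤n)) small
    where
    d-inj = cols₃-injective a≢b a≢p b≢p
    R : Realisation (outer-row-edge-H i) n
    R = record { d = cols₃ a b p ; d-injective = d-inj ; other = a ; other-type = λ ()
               ; A = adj (removeEdge H (vtx i a) (vtx i b))
               ; A-type = Typed.removeEdge-H-typed (cols₃ a b p) d-inj 2F i 0F i 1F }

  outer-row-edge-at-p : ∀ i → Check.valid (outer-row-edge-at-p-H i) ≡ true →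
    Certificate.cutᵗ (outer-row-edge-at-p-H i) 1F (just 0F) ≡ true →
    (∀ c → n ≡ c + 2 → 3 * cutSize (outer-row-edge-at-p-H i) c < 3 + 3 * suc n) →
    ∀ {b} → p ≢ b → Refuted (vtx i p) (vtx i b)
  outer-row-edge-at-p i W-valid cut-w small {b} p≢b =
    Refute.Deleted.¬tough-deleted (outer-row-edge-at-p-H i) W-valid R 0F cut-w (s≤s (s≤s z≤n)) small
    where
    d-inj = cols₂-injective p≢b
    R : Realisation (outer-row-edge-at-p-H i) n
    R = record { d = cols₂ p b ; d-injective = d-inj ; other = b ; other-type = λ ()
               ; A = adj (removeEdge H (vtx i p) (vtx i b))
               ; A-type = Typed.removeEdge-H-typed (cols₂ p b) d-inj 0F i 0F i 1F }

  refuted-outer-row-edge-at-p : ∀ i → i ≢ 1F → ∀ {b} → p ≢ b → Refuted (vtx i p) (vtx i b)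
  refuted-outer-row-edge-at-p 0F _   = outer-row-edge-at-p 0F refl refl (small-cut+w 2)
  refuted-outer-row-edge-at-p 1F 1≢1 = ⊥-elim (1≢1 refl)
  refuted-outer-row-edge-at-p 2F _   = outer-row-edge-at-p 2F refl refl (small-cut+w 2)

  refuted-outer-row-edge : ∀ i → i ≢ 1F → ∀ {q r} → q ≢ r → Refuted (vtx i q) (vtx i r)
  refuted-outer-row-edge i i≢1 {q} {r} q≢r with q ≟ p | r ≟ p
  ... | yes refl | _        = refuted-outer-row-edge-at-p i i≢1 q≢r
  ... | no q≢p   | yes refl = refuted-comm (vtx i p) (vtx i q) (refuted-outer-row-edge-at-p i i≢1 (q≢p ∘ sym))
  ... | no q≢p   | no r≢p   = away i i≢1 q≢r q≢p r≢p
    where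
    away : ∀ i → i ≢ 1F → ∀ {a b} → a ≢ b → a ≢ p → b ≢ p → Refuted (vtx i a) (vtx i b)
    away 0F _   = outer-row-edge 0F refl refl (small-cut+w 3)
    away 1F 1≢1 = ⊥-elim (1≢1 refl)
    away 2F _   = outer-row-edge 2F refl refl (small-cut+w 3)

  refuted-middle-row-edge : ∀ {a b} → a ≢ b → a ≢ p → b ≢ p → Refuted (vtx 1F a) (vtx 1F b)
  refuted-middle-row-edge {a} {b} a≢b a≢p b≢p with n ℕ.≟ 3
  ... | yes n≡3 = Refute.Deleted.¬tough-deleted middle-row-edge-H₃ refl R₃ 2F refl ℕ.≤-refl (λ c → small₃ c n≡3)
    where
    d-inj = cols₃-injective a≢b a≢p b≢p
    R₃ : Realisation middle-row-edge-H₃ n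
    R₃ = record { d = cols₃ a b p ; d-injective = d-inj ; other = a ; other-type = λ ()
                ; A = adj (removeEdge H (vtx 1F a) (vtx 1F b))
                ; A-type = Typed.removeEdge-H-typed (cols₃ a b p) d-inj 2F 1F 0F 1F 1F }
    small₃ : ∀ {n} c → n ≡ 3 → n ≡ c + 3 → 3 * (3 * c + 3) < 3 + 2 * suc n
    small₃ c refl 3≡c+3 rewrite ℕ.+-cancelʳ-≡ 3 c 0 (sym 3≡c+3) = ℕ.n≤1+n 10
  ... | no n≢3  = Refute.Deleted.¬tough-deleted middle-row-edge-H refl R 2F refl (s≤s (s≤s z≤n)) small₄
    where
    d-inj = cols₃-injective a≢b a≢p b≢p
    o = fresh (ℕ.≤∧≢⇒< n≥3 (n≢3 ∘ sym)) (cols₃ a b p)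
    R : Realisation middle-row-edge-H n
    R = record { d = cols₃ a b p ; d-injective = d-inj ; other = proj₁ o
               ; other-type = λ _ → typeOf-nothing (cols₃ a b p) (proj₁ o) (proj₂ o)
               ; A = adj (removeEdge H (vtx 1F a) (vtx 1F b))
               ; A-type = Typed.removeEdge-H-typed (cols₃ a b p) d-inj 2F 1F 0F 1F 1F }
    small₄ : ∀ {n} c → n ≡ c + 3 → 3 * (1 * c + 6) < 3 + 4 * suc n
    small₄ c refl = <-by-gap c (eq c)
      where
      eq : ∀ c → suc (3 * (1 * c + 6) + c) ≡ 3 + 4 * suc (c + 3)
      eq = solve-∀

  column-edge : ∀ i → Check.valid (column-edge-H i) ≡ true →
    Certificate.cutᵗ (column-edge-H i) 1F (just 1F) ≡ true →
    (∀ c → n ≡ c + 2 → 3 * cutSize (column-edge-H i) c < 3 + 3 * suc n) →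
    ∀ {a} → a ≢ p → Refuted (vtx i a) (vtx 1F a)
  column-edge i W-valid cut-w small {a} a≢p =
    Refute.Deleted.¬tough-deleted (column-edge-H i) W-valid R 1F cut-w (s≤s (s≤s z≤n)) small
    where
    d-inj = cols₂-injective a≢p
    R : Realisation (column-edge-H i) n
    R = record { d = cols₂ a p ; d-injective = d-inj ; other = a ; other-type = λ ()
               ; A = adj (removeEdge H (vtx i a) (vtx 1F a))
               ; A-type = Typed.removeEdge-H-typed (cols₂ a p) d-inj 1F i 0F 1F 0F }

  refuted-column-edge : ∀ i → i ≢ 1F → ∀ {a} → a ≢ p → Refuted (vtx i a) (vtx 1F a)
  refuted-column-edge 0F _   = column-edge 0F refl refl (small-cut+w 2)
  refuted-column-edge 1F 1≢1 = ⊥-elim (1≢1 refl)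
  refuted-column-edge 2F _   = column-edge 2F refl refl (small-cut+w 2)

  refuted-shortcut : Refuted (vtx 0F p) (vtx 2F p)
  refuted-shortcut = Refute.Deleted.¬tough-deleted shortcut-edge-H refl R 1F refl (s≤s (s≤s z≤n)) (small-cut+w 2)
    where
    a = fresh n≥2 (cols₁ p)
    d-inj = cols₂-injective (proj₂ a 0F)
    R : Realisation shortcut-edge-H n
    R = record { d = cols₂ (proj₁ a) p ; d-injective = d-inj ; other = proj₁ a ; other-type = λ ()
               ; A = adj (removeEdge H (vtx 0F p) (vtx 2F p))
               ; A-type = Typed.removeEdge-H-typed (cols₂ (proj₁ a) p) d-inj 1F 0F 1F 2F 1F }

  refuted-edge : ∀ u v → u ≢ w → v ≢ w → adjH n p u v ≡ true → Refuted u v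
  refuted-edge = ∀-vtx² (λ u v → u ≢ w → v ≢ w → adjH n p u v ≡ true → Refuted u v) λ i q j r u≢w v≢w uv →
    [ (λ kp → kp-edge i q j r u≢w v≢w (adjKP-edge n i q j r kp))
    , (λ sc → shortcut-edge i q j r (isShortcut-vtx n p i q j r sc)) ]′ (∨-cases (adjKP n (vtx i q) (vtx j r)) uv)
    where
    off-w : ∀ {q} → vtx 1F q ≢ w → q ≢ p
    off-w 1q≢w refl = 1q≢w refl
    kp-edge : ∀ i q j r → vtx i q ≢ w → vtx j r ≢ w → (i ≡ j × q ≢ r) ⊎ (q ≡ r × adjP3 i j ≡ true) →
      Refuted (vtx i q) (vtx j r)
    kp-edge i q .i r u≢w v≢w (inj₁ (refl , q≢r)) with i ≟ 1F
    ... | yes refl = refuted-middle-row-edge q≢r (off-w u≢w) (off-w v≢w)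
    ... | no i≢1   = refuted-outer-row-edge i i≢1 q≢r
    kp-edge i q j .q u≢w v≢w (inj₂ (refl , ij)) with adjP3-edge i j ij
    ... | inj₁ (i≢1 , refl) = refuted-column-edge i i≢1 (off-w v≢w)
    ... | inj₂ (refl , j≢1) = refuted-comm (vtx j q) (vtx 1F q) (refuted-column-edge j j≢1 (off-w u≢w))
    shortcut-edge : ∀ i q j r → (i ≡ 0F × j ≡ 2F × q ≡ p × r ≡ p) ⊎ (i ≡ 2F × j ≡ 0F × q ≡ p × r ≡ p) →
      Refuted (vtx i q) (vtx j r)
    shortcut-edge _ _ _ _ (inj₁ (refl , refl , refl , refl)) = refuted-shortcut
    shortcut-edge _ _ _ _ (inj₂ (refl , refl , refl , refl)) = refuted-comm (vtx 0F p) (vtx 2F p) refuted-shortcut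

  ¬tough-removeEdge-G₀ : ∀ x y → adj (G₀ n p) x y ≡ true → ¬ Tough (removeEdge (G₀ n p) x y) (τ n)
  ¬tough-removeEdge-G₀ x y xy = ¬tough-cong (deleteVertex-removeEdge (adjH n p) w x y)
    (refuted-edge (punchIn w x) (punchIn w y) (punchInᵢ≢i w x) (punchInᵢ≢i w y) xy)

mainTheorem4 : (n : ℕ) → 3 ≤ n →
    (¬ (∃ λ r → Regular (KnP3 n) r)
    × MinimallyTough (KnP3 n) ((+ (suc n)) / 3)
    × MinDegreeIs (KnP3 n) n
    × MaxDegreeIs (KnP3 n) (suc n))
    × (∀ (p : Fin n) → Regular (G₀ n p) n × MinimallyTough (G₀ n p) ((+ (suc n)) / 3))
mainTheorem4 (suc n) n≥3 =
  ( ¬regular-KP (suc n) fz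
  , ((tough-K , ¬tougher-K) , ¬tough-removeEdge)
  , minDegree-KP (suc n) fz
  , maxDegree-KP (suc n) fz )
  , λ p → let open G₀-toughness n n≥3 p using (tough-G₀; ¬tougher-G₀; ¬tough-removeEdge-G₀) in
      regular-G₀ n p , (tough-G₀ , ¬tougher-G₀) , ¬tough-removeEdge-G₀
  where open KnP3-toughness (suc n) n≥3
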